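{- A cirquent (or formula) is provable in $\mathbf{CL5}$ if and only if it is trivial.
   Context: Formulas: built from infinitely many propositional atoms (no constants) using $\neg,\wedge,\vee$ (binary), $\neg$ only on atoms; $\neg\neg F$, $\neg(F\wedge G)$, $\neg(F\vee G)$ abbreviate $F$, $\neg F\vee\neg G$, $\neg F\wedge\neg G$. A $k$-ary cirquent is a pair consisting of a structure, i.e. a finite sequence ($m\ge0$, repetitions allowed) of subsets of $\{1,\dots,k\}$ (ogroups), and a pool $\langle F_1,\dots,F_k\rangle$ of formulas (oformulas); ogroup $\Gamma$ contains $F_i$ for $i\in\Gamma$; a formula $F$ is identified with the cirquent $(\langle\{1\}\rangle,\langle F\rangle)$. Rules of $\mathbf{CL5}$: (A) axioms: the empty cirquent and $(\langle\{1,2\}\rangle,\langle\neg F,F\rangle)$; (M) mix: from $(\langle\Gamma_1..\Gamma_m\rangle,\langle F_1..F_k\rangle)$ and $(\langle\Delta_1..\Delta_n\rangle,\langle G_1..G_l\rangle)$ infer $(\langle\Gamma_1,..,\Gamma_m,\Delta_1+k,..,\Delta_n+k\rangle,\langle F_1,..,F_k,G_1,..,G_l\rangle)$, $\Delta+k=\{j+k:j\in\Delta\}$; (E) exchange: swap two adjacent oformulas (ogroups keep the same oformulas) or two adjacent ogroups; (W) weakening: add to an ogroup the index of an existing oformula, or insert a new formula anywhere in the pool; (D) duplication: replace an ogroup $\Gamma$ by adjacent $\Gamma,\Gamma$, or the reverse; ($\vee$) merge adjacent oformulas $F,G$ into $F\vee G$, contained in exactly the ogroups that contained $F$ or $G$;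 ($\wedge$) when for adjacent oformulas $F,G$ no ogroup contains both, every ogroup containing $F$ is immediately followed by an ogroup containing $G$, and every ogroup containing $G$ is immediately preceded by an ogroup containing $F$: replace each such pair of adjacent ogroups by their union, then merge $F,G$ into $F\wedge G$. Proofs are finite trees of cirquents, each node following from its children by a rule. Resources: a port is an atom $P$ (output) or $-P$ (input), $P$ its type; an interface is a finite sequence of ports, a situation a bit string of the same length; $\mathbf s\le\mathbf s'$ iff $\mathbf s(i)\le\mathbf s'(i)$ at outputs and $\mathbf s'(i)\le\mathbf s(i)$ at inputs; a resource is an interface with a $\le$-monotone function from situations to $\{0,1\}$ (1 = true). For a cirquent $C$: a situation assigns truth values to all atom occurrences in its oformulas; oformulas are evaluated by classical clauses on occurrences ($\neg P$ true iff that occurrence of $P$ false), groups by disjunction, $C$ by conjunction of its groups. $C^\clubsuit$ has interface $\langle\mathrm{Port}(L_1),\dots,\mathrm{Port}(L_n)\rangle$ ($L_i$ the literal occurrences of $C$ in order; $\mathrm{Port}(P)=P$, $\mathrm{Port}(\neg P)=-P$) and is true in $\mathbf s$ iff $C$ is. An allocation for a resource is a pair $(X,Y)$ of an input occurrence $X$ and an output occurrence $Y$ of its interface of the same type; an arrangement is a set of allocations, monogamous iff no port occurrence is in more than one allocation. A situation is consistent with $\mathcal A$ iff $\mathbf s(X)\le\mathbf s(Y)$ for all $(X,Y)\in\mathcal A$; $\mathcal A$ is trivializing iff the resource is true in all situations consistent with $\mathcal A$. A resource is trivial iff it has a monogamous trivializing arrangement; a cirquent or formula $C$ is trivial iff $C^\clubsuit$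 is. -}

module Defs where

open import Data.Nat.Base using (ℕ; zero; suc; _+_)
open import Data.Bool.Base using (Bool; true; false; not; if_then_else_)
  renaming (_∧_ to _∧ᵇ_; _∨_ to _∨ᵇ_)
open import Data.Fin.Base using (Fin)
open import Data.Fin.Subset using (Subset; inside; outside; _∪_)
open import Data.Vec.Base as V using (Vec; []; _∷_; _++_; replicate; take; drop; insertAt; _[_]≔_)
open import Data.List.Base as L using (List; []; _∷_; map; _∷ʳ_)
  renaming (_++_ to _++ˡ_)
open import Data.List.Relation.Unary.All using (All)
open import Data.List.Relation.Unary.Unique.Propositional using (Unique)
open import Data.Product.Base using (Σ; ∃; _×_; _,_)
open import Relation.Binary.PropositionalEquality using (_≡_)
open import Relation.Nullary using (¬_)

infixr 6 _∧_
infixr 5 _∨_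

data Formula : Set where
  atom  : ℕ → Formula
  natom : ℕ → Formula
  _∧_   : Formula → Formula → Formula
  _∨_   : Formula → Formula → Formula

neg : Formula → Formula
neg (atom P)  = natom P
neg (natom P) = atom P
neg (F ∧ G)   = neg F ∨ neg G
neg (F ∨ G)   = neg F ∧ neg G

-- Cirquents: k oformulas (the pool), a finite sequence of ogroups,
-- each ogroup a subset of {1..k} (represented as Subset k = Vec Bool k)

data Cirquent : Set where
  cq : (k : ℕ) → List (Subset k) → Vec Formula k → Cirquent

-- a formula F is identified with the cirquent (⟨{1}⟩, ⟨F⟩)
formulaCirquent : Formula → Cirquent
formulaCirquent F = cq 1 ((inside ∷ []) ∷ []) (F ∷ [])

-- Positional helpers: position a and a+1 of a vector of length a+2+b

swapAdj : {X : Set} (a : ℕ) {b : ℕ} → Vec X (a + suc (suc b)) → Vec X (a + suc (suc b))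
swapAdj zero    (x ∷ y ∷ v) = y ∷ x ∷ v
swapAdj (suc a) (x ∷ v)     = x ∷ swapAdj a v

mergeWith : {X : Set} (a : ℕ) {b : ℕ} → (X → X → X) → Vec X (a + suc (suc b)) → Vec X (a + suc b)
mergeWith zero    f (x ∷ y ∷ v) = f x y ∷ v
mergeWith (suc a) f (x ∷ v)     = x ∷ mergeWith a f v

fstOf : {X : Set} (a : ℕ) {b : ℕ} → Vec X (a + suc (suc b)) → X
fstOf zero    (x ∷ y ∷ v) = x
fstOf (suc a) (x ∷ v)     = fstOf a v

sndOf : {X : Set} (a : ℕ) {b : ℕ} → Vec X (a + suc (suc b)) → X
sndOf zero    (x ∷ y ∷ v) = y
sndOf (suc a) (x ∷ v)     = sndOf a v

pairUnion : (a : ℕ) {b : ℕ} → List (Subset (a + suc (suc b))) → List (Subset (a + suc (suc b)))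
pairUnion a []                    = []
pairUnion a (Γ ∷ [])              = Γ ∷ []
pairUnion a (Γ ∷ rest@(Δ ∷ r)) =
  if fstOf a Γ then (Γ ∪ Δ) ∷ pairUnion a r else Γ ∷ pairUnion a rest

AndCondition : (a : ℕ) {b : ℕ} → List (Subset (a + suc (suc b))) → Set
AndCondition a S =
  All (λ Γ → ¬ (fstOf a Γ ≡ true × sndOf a Γ ≡ true)) S
  × (∀ xs Γ ys → S ≡ xs ++ˡ (Γ ∷ ys) → fstOf a Γ ≡ true →
       Σ _ λ Δ → Σ _ λ ys′ → ys ≡ Δ ∷ ys′ × sndOf a Δ ≡ true)
  × (∀ xs Γ ys → S ≡ xs ++ˡ (Γ ∷ ys) → sndOf a Γ ≡ true →
       Σ _ λ xs′ → Σ _ λ Δ → xs ≡ xs′ ∷ʳ Δ × fstOf a Δ ≡ true)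

data Provable : Cirquent → Set where
  ax-empty : Provable (cq 0 [] [])
  ax-id    : (F : Formula) →
             Provable (cq 2 ((inside ∷ inside ∷ []) ∷ []) (neg F ∷ F ∷ []))
  mix : ∀ {k l} {Γs : List (Subset k)} {Fs : Vec Formula k}
          {Δs : List (Subset l)} {Gs : Vec Formula l} →
        Provable (cq k Γs Fs) → Provable (cq l Δs Gs) →
        Provable (cq (k + l)
                   (map (λ Γ → Γ ++ replicate l outside) Γs
                     ++ˡ map (λ Δ → replicate k outside ++ Δ) Δs)
                   (Fs ++ Gs))
  exch-formula : ∀ a {b} {S : List (Subset (a + suc (suc b)))} {P} →
        Provable (cq _ S P) →
        Provable (cq _ (map (swapAdj a) S) (swapAdj a P))
  exch-group : ∀ {k} (xs : List (Subset k)) Γ Δ ys {P} →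
        Provable (cq k (xs ++ˡ (Γ ∷ Δ ∷ ys)) P) →
        Provable (cq k (xs ++ˡ (Δ ∷ Γ ∷ ys)) P)
  weak-group : ∀ {k} (xs : List (Subset k)) Γ ys (i : Fin k) {P} →
        Provable (cq k (xs ++ˡ (Γ ∷ ys)) P) →
        Provable (cq k (xs ++ˡ ((Γ [ i ]≔ inside) ∷ ys)) P)
  weak-formula : ∀ {k} {S : List (Subset k)} {P} (i : Fin (suc k)) (F : Formula) →
        Provable (cq k S P) →
        Provable (cq (suc k) (map (λ Γ → insertAt Γ i outside) S) (insertAt P i F))
  dup : ∀ {k} (xs : List (Subset k)) Γ ys {P} →
        Provable (cq k (xs ++ˡ (Γ ∷ ys)) P) →
        Provable (cq k (xs ++ˡ (Γ ∷ Γ ∷ ys)) P)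
  undup : ∀ {k} (xs : List (Subset k)) Γ ys {P} →
        Provable (cq k (xs ++ˡ (Γ ∷ Γ ∷ ys)) P) →
        Provable (cq k (xs ++ˡ (Γ ∷ ys)) P)
  or-rule : ∀ a {b} {S : List (Subset (a + suc (suc b)))} {P} →
        Provable (cq _ S P) →
        Provable (cq _ (map (mergeWith a _∨ᵇ_) S) (mergeWith a _∨_ P))
  and-rule : ∀ a {b} {S : List (Subset (a + suc (suc b)))} {P} →
        AndCondition a S →
        Provable (cq _ S P) →
        Provable (cq _ (map (mergeWith a _∨ᵇ_) (pairUnion a S)) (mergeWith a _∧_ P))

data Port : Set where
  out : ℕ → Port
  inp : ℕ → Port

IsAllocation : ∀ {n} → Vec Port n → Fin n × Fin n → Set
IsAllocation ports (X , Y) =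
  Σ ℕ λ P → (V.lookup ports X ≡ inp P) × (V.lookup ports Y ≡ out P)

endpoints : ∀ {n} → List (Fin n × Fin n) → List (Fin n)
endpoints []            = []
endpoints ((X , Y) ∷ A) = X ∷ Y ∷ endpoints A

Monogamous : ∀ {n} → List (Fin n × Fin n) → Set
Monogamous A = Unique (endpoints A)

Consistent : ∀ {n} → Vec Bool n → List (Fin n × Fin n) → Set
Consistent s A = All (λ { (X , Y) → V.lookup s X ≡ true → V.lookup s Y ≡ true }) A

TrivialResource : ∀ {n} → Vec Port n → (Vec Bool n → Bool) → Set
TrivialResource {n} ports f =
  Σ (List (Fin n × Fin n)) λ A →
    All (IsAllocation ports) A × Monogamous A ×
    (∀ s → Consistent s A → f s ≡ true)

nlits : Formula → ℕ
nlits (atom _)  = 1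
nlits (natom _) = 1
nlits (F ∧ G)   = nlits F + nlits G
nlits (F ∨ G)   = nlits F + nlits G

nlitsPool : ∀ {k} → Vec Formula k → ℕ
nlitsPool []      = 0
nlitsPool (F ∷ P) = nlits F + nlitsPool P

portsF : (F : Formula) → Vec Port (nlits F)
portsF (atom P)  = out P ∷ []
portsF (natom P) = inp P ∷ []
portsF (F ∧ G)   = portsF F ++ portsF G
portsF (F ∨ G)   = portsF F ++ portsF G

portsPool : ∀ {k} (P : Vec Formula k) → Vec Port (nlitsPool P)
portsPool []      = []
portsPool (F ∷ P) = portsF F ++ portsPool P

evalF : (F : Formula) → Vec Bool (nlits F) → Bool
evalF (atom _)  (v ∷ []) = v
evalF (natom _) (v ∷ []) = not v
evalF (F ∧ G)   s = evalF F (take (nlits F) s) ∧ᵇ evalF G (drop (nlits F) s)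
evalF (F ∨ G)   s = evalF F (take (nlits F) s) ∨ᵇ evalF G (drop (nlits F) s)

evalPool : ∀ {k} (P : Vec Formula k) → Vec Bool (nlitsPool P) → Vec Bool k
evalPool []      s = []
evalPool (F ∷ P) s = evalF F (take (nlits F) s) ∷ evalPool P (drop (nlits F) s)

evalGroup : ∀ {k} → Subset k → Vec Bool k → Bool
evalGroup []      []      = false
evalGroup (g ∷ Γ) (v ∷ w) = (g ∧ᵇ v) ∨ᵇ evalGroup Γ w

allGroups : ∀ {k} → List (Subset k) → Vec Bool k → Bool
allGroups []      w = true
allGroups (Γ ∷ S) w = evalGroup Γ w ∧ᵇ allGroups S w

nlitsC : Cirquent → ℕ
nlitsC (cq k S P) = nlitsPool P

portsC : (C : Cirquent) → Vec Port (nlitsC C)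
portsC (cq k S P) = portsPool P

truthC : (C : Cirquent) → Vec Bool (nlitsC C) → Bool
truthC (cq k S P) s = allGroups S (evalPool P s)

Trivial : Cirquent → Set
Trivial C = TrivialResource (portsC C) (truthC C)

{-# OPTIONS --safe #-}
module Submission where

-- Soundness: each rule preserves triviality.  Reading situations as bit
-- streams and interfaces as port lists, the structural rules either keep a
-- trivializing arrangement or carry it along an injective renumbering of
-- the ports, mix juxtaposes two arrangements, and the ∨ and ∧ rules keep
-- the ports and only weaken the truth condition.  The axiom ¬F, F is a
-- single allocation when F is a literal, and otherwise follows from the
-- axioms for the immediate subformulas of F by mix, an exchange and the
-- two connective rules.
--
-- Completeness: the ∨ and ∧ rules are invertible for triviality, so by
-- induction on the number of connectives it suffices to consider
-- cirquents of literals.  There a monogamous trivializing arrangement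
-- joins some pair ¬P, P inside every group, and distinct allocations are
-- disjoint; a cirquent whose groups are covered by disjoint complementary
-- pairs is built from axioms by mix, exchange, duplication and weakening,
-- removing one pair at a time.

open import Defs
open import Function.Bundles using (_⇔_; mk⇔)
open import Data.Product.Base using (Σ; _×_; _,_; proj₁; proj₂)

open import Data.Bool.Base using (Bool; true; false; not; if_then_else_)
  renaming (_∧_ to _∧ᵇ_; _∨_ to _∨ᵇ_)
open import Data.Bool.Properties using (not-injective)
  renaming (_≟_ to _≟ᵇ_; ∨-zeroʳ to ∨ᵇ-zeroʳ; ∨-idem to ∨ᵇ-idem)
open import Data.Bool.Solver using (module ∨-∧-Solver)
open ∨-∧-Solver using (solve; _:=_; _:+_; _:*_)
open import Data.Empty using (⊥-elim)
open import Data.Fin.Base as Fin using (Fin; toℕ)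
import Data.Fin.Properties as FinP
open import Data.Fin.Subset using (Subset; inside; outside; _∪_; _∈_; _⊆_)
open import Data.Fin.Subset.Properties using (_∈?_; ∪-idem)
open import Data.List.Base as L using (List; []; _∷_; map; filter; _∷ʳ_)
  renaming (_++_ to _++ˡ_)
import Data.List.Properties as LP
open import Data.List.Membership.Propositional using (find) renaming (_∈_ to _∈ˡ_)
open import Data.List.Relation.Unary.All as All using (All; []; _∷_)
import Data.List.Relation.Unary.All.Properties as AllP
open import Data.List.Relation.Unary.AllPairs using ([]; _∷_)
open import Data.List.Relation.Unary.Any using (Any; here; there)
open import Data.List.Relation.Unary.Unique.Propositional using (Unique)
import Data.List.Relation.Unary.Unique.Propositional.Properties as UniqueP
open import Data.List.Relation.Binary.Disjoint.Propositional using (Disjoint)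
open import Data.List.Relation.Binary.Pointwise as Pointwise using (Pointwise; []; _∷_)
open import Data.List.Relation.Binary.Permutation.Propositional as Perm using (_↭_)
import Data.List.Relation.Binary.Permutation.Setoid.Properties as PermSetoidP
open import Data.Maybe.Base using (Maybe; just; nothing)
open import Data.Nat.Base using (ℕ; zero; suc; _+_; _∸_; _≤_; _<_; z≤n; s≤s)
open import Data.Nat.Induction using (<-wellFounded)
open import Data.Nat.Properties
  using (_<?_; +-assoc; +-comm; +-suc; +-cancelˡ-≡; +-monoʳ-<; ≤-reflexive; ≤-trans; <⇒≱; m≤m+n; m+n≮m; m+n∸m≡n)
open import Data.Sum.Base using (_⊎_; inj₁; inj₂)
open import Data.Vec.Base as V
  using (Vec; []; _∷_; _++_; take; drop; replicate; insertAt; _[_]≔_; _[_]=_; here; there)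
import Data.Vec.Properties as VP
open import Data.Vec.Relation.Unary.All as VAll using () renaming (All to VAll)
open import Function.Base using (_∘_; id; const)
open import Induction.WellFounded using (Acc; acc)
open import Relation.Binary.PropositionalEquality
open import Relation.Binary.PropositionalEquality.Properties using () renaming (setoid to ≡-setoid)
open import Relation.Nullary using (¬_; yes; no)
open import Relation.Nullary.Decidable using (_×-dec_; _→-dec_)
open import Relation.Unary using (Decidable)
open import Relation.Unary.Properties using (∁?)

false≢true : false ≢ true
false≢true ()

∧-true⁻ : ∀ x y → x ∧ᵇ y ≡ true → x ≡ true × y ≡ true
∧-true⁻ true true refl = refl , refl

∨-monoˡ-true : ∀ {x y} z → (x ≡ true → y ≡ true) → x ∨ᵇ z ≡ true → y ∨ᵇ z ≡ true
∨-monoˡ-true {true}      z x⇒y _ = cong (_∨ᵇ z) (x⇒y refl)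
∨-monoˡ-true {false} {y} z _   e = trans (cong (y ∨ᵇ_) e) (∨ᵇ-zeroʳ y)

∨-left-swap : ∀ x y z → x ∨ᵇ (y ∨ᵇ z) ≡ y ∨ᵇ (x ∨ᵇ z)
∨-left-swap = solve 3 (λ x y z → x :+ (y :+ z) := y :+ (x :+ z)) refl

∨-left-rotate : ∀ x y z r → x ∨ᵇ (y ∨ᵇ (z ∨ᵇ r)) ≡ y ∨ᵇ (z ∨ᵇ (x ∨ᵇ r))
∨-left-rotate = solve 4 (λ x y z r → x :+ (y :+ (z :+ r)) := y :+ (z :+ (x :+ r))) refl

∧-distribʳ-∨-interchange : ∀ g d x r s →
  ((g ∨ᵇ d) ∧ᵇ x) ∨ᵇ (r ∨ᵇ s) ≡ ((g ∧ᵇ x) ∨ᵇ r) ∨ᵇ ((d ∧ᵇ x) ∨ᵇ s)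
∧-distribʳ-∨-interchange =
  solve 5 (λ g d x r s → ((g :+ d) :* x) :+ (r :+ s) := ((g :* x) :+ r) :+ ((d :* x) :+ s)) refl

∧-distribˡ-∨-assoc : ∀ g x y r → (g ∧ᵇ (x ∨ᵇ y)) ∨ᵇ r ≡ (g ∧ᵇ x) ∨ᵇ ((g ∧ᵇ y) ∨ᵇ r)
∧-distribˡ-∨-assoc = solve 4 (λ g x y r → (g :* (x :+ y)) :+ r := (g :* x) :+ ((g :* y) :+ r)) refl

merge-∨-true : ∀ x y u v r → (x ∧ᵇ u) ∨ᵇ ((y ∧ᵇ v) ∨ᵇ r) ≡ true → ((x ∨ᵇ y) ∧ᵇ (u ∨ᵇ v)) ∨ᵇ r ≡ true
merge-∨-true x y u v r e = trans
  (solve 5 (λ x y u v r → ((x :+ y) :* (u :+ v)) :+ r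
                        := ((x :* u) :+ ((y :* v) :+ r)) :+ ((x :* v) :+ (y :* u))) refl x y u v r)
  (cong (_∨ᵇ ((x ∧ᵇ v) ∨ᵇ (y ∧ᵇ u))) e)

merge-∧-true : ∀ u v r s → u ∨ᵇ r ≡ true → v ∨ᵇ s ≡ true → (u ∧ᵇ v) ∨ᵇ (r ∨ᵇ s) ≡ true
merge-∧-true true  true  r s _  _  = refl
merge-∧-true false v     r s eᵣ _  rewrite eᵣ = refl
merge-∧-true true  false r s _  eₛ rewrite eₛ = ∨ᵇ-zeroʳ r

-- Interfaces become lists and situations streams ℕ → Bool, read from
-- position 0 on; renumbering ports then needs no Vec-length arithmetic.

Pair : Set → Set
Pair X = X × X

map-pair : ∀ {X Y : Set} → (X → Y) → Pair X → Pair Y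
map-pair ρ (x , y) = ρ x , ρ y

lookupℕ : {X : Set} → List X → ℕ → Maybe X
lookupℕ []       _       = nothing
lookupℕ (x ∷ xs) zero    = just x
lookupℕ (x ∷ xs) (suc i) = lookupℕ xs i

portListF : Formula → List Port
portListF (atom p)  = out p ∷ []
portListF (natom p) = inp p ∷ []
portListF (F ∧ G)   = portListF F ++ˡ portListF G
portListF (F ∨ G)   = portListF F ++ˡ portListF G

portListPool : ∀ {k} → Vec Formula k → List Port
portListPool []      = []
portListPool (F ∷ P) = portListF F ++ˡ portListPool P

portList : Cirquent → List Port
portList (cq k S P) = portListPool P

shift : ℕ → (ℕ → Bool) → (ℕ → Bool)
shift n σ i = σ (n + i)

evalFˢ : Formula → (ℕ → Bool) → Bool
evalFˢ (atom _)  σ = σ 0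
evalFˢ (natom _) σ = not (σ 0)
evalFˢ (F ∧ G)   σ = evalFˢ F σ ∧ᵇ evalFˢ G (shift (nlits F) σ)
evalFˢ (F ∨ G)   σ = evalFˢ F σ ∨ᵇ evalFˢ G (shift (nlits F) σ)

evalPoolˢ : ∀ {k} → Vec Formula k → (ℕ → Bool) → Vec Bool k
evalPoolˢ []      σ = []
evalPoolˢ (F ∷ P) σ = evalFˢ F σ ∷ evalPoolˢ P (shift (nlits F) σ)

truthˢ : Cirquent → (ℕ → Bool) → Bool
truthˢ (cq k S P) σ = allGroups S (evalPoolˢ P σ)

IsAllocationˢ : List Port → Pair ℕ → Set
IsAllocationˢ L (x , y) = Σ ℕ λ p → lookupℕ L x ≡ just (inp p) × lookupℕ L y ≡ just (out p)

endpointsˢ : List (Pair ℕ) → List ℕ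
endpointsˢ []            = []
endpointsˢ ((x , y) ∷ A) = x ∷ y ∷ endpointsˢ A

Respects : (ℕ → Bool) → Pair ℕ → Set
Respects σ (x , y) = σ x ≡ true → σ y ≡ true

record Trivialˢ (C : Cirquent) : Set where
  constructor trivialˢ
  field
    arrangement  : List (Pair ℕ)
    allocations  : All (IsAllocationˢ (portList C)) arrangement
    monogamous   : Unique (endpointsˢ arrangement)
    trivializing : ∀ σ → All (Respects σ) arrangement → truthˢ C σ ≡ true

toList-portsF : ∀ F → V.toList (portsF F) ≡ portListF F
toList-portsF (atom p)  = refl
toList-portsF (natom p) = refl
toList-portsF (F ∧ G)   = trans (VP.toList-++ (portsF F) (portsF G)) (cong₂ _++ˡ_ (toList-portsF F) (toList-portsF G))
toList-portsF (F ∨ G)   = trans (VP.toList-++ (portsF F) (portsF G)) (cong₂ _++ˡ_ (toList-portsF F) (toList-portsF G))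

toList-portsPool : ∀ {k} (P : Vec Formula k) → V.toList (portsPool P) ≡ portListPool P
toList-portsPool []      = refl
toList-portsPool (F ∷ P) =
  trans (VP.toList-++ (portsF F) (portsPool P)) (cong₂ _++ˡ_ (toList-portsF F) (toList-portsPool P))

toList-portsC : ∀ C → V.toList (portsC C) ≡ portList C
toList-portsC (cq k S P) = toList-portsPool P

lookupℕ-toList : ∀ {X : Set} {n} (v : Vec X n) (i : Fin n) → lookupℕ (V.toList v) (toℕ i) ≡ just (V.lookup v i)
lookupℕ-toList (x ∷ v) Fin.zero    = refl
lookupℕ-toList (x ∷ v) (Fin.suc i) = lookupℕ-toList v i

lookupℕ-toList⁻ : ∀ {X : Set} {n} (v : Vec X n) x {p} → lookupℕ (V.toList v) x ≡ just p →
                  Σ (Fin n) λ i → toℕ i ≡ x × V.lookup v i ≡ p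
lookupℕ-toList⁻ (y ∷ v) zero    refl = Fin.zero , refl , refl
lookupℕ-toList⁻ (y ∷ v) (suc x) e with lookupℕ-toList⁻ v x e
... | i , refl , vᵢ = Fin.suc i , refl , vᵢ

stream : ∀ {n} → Vec Bool n → ℕ → Bool
stream []      _       = false
stream (b ∷ s) zero    = b
stream (b ∷ s) (suc i) = stream s i

stream-toℕ : ∀ {n} (s : Vec Bool n) (i : Fin n) → stream s (toℕ i) ≡ V.lookup s i
stream-toℕ (b ∷ s) Fin.zero    = refl
stream-toℕ (b ∷ s) (Fin.suc i) = stream-toℕ s i

Agree : ∀ {n} → (ℕ → Bool) → Vec Bool n → Set
Agree {n} σ s = ∀ (i : Fin n) → σ (toℕ i) ≡ V.lookup s i

agree-take : ∀ m {n} σ (s : Vec Bool (m + n)) → Agree σ s → Agree σ (take m s)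
agree-take (suc m) σ (b ∷ s) ag Fin.zero    = ag Fin.zero
agree-take (suc m) σ (b ∷ s) ag (Fin.suc i) = agree-take m (shift 1 σ) s (λ j → ag (Fin.suc j)) i

agree-drop : ∀ m {n} σ (s : Vec Bool (m + n)) → Agree σ s → Agree (shift m σ) (drop m s)
agree-drop zero    σ s       ag = ag
agree-drop (suc m) σ (b ∷ s) ag = agree-drop m (shift 1 σ) s (λ i → ag (Fin.suc i))

evalF-agree : ∀ F σ (s : Vec Bool (nlits F)) → Agree σ s → evalF F s ≡ evalFˢ F σ
evalF-agree (atom p)  σ (b ∷ []) ag = sym (ag Fin.zero)
evalF-agree (natom p) σ (b ∷ []) ag = cong not (sym (ag Fin.zero))
evalF-agree (F ∧ G)   σ s        ag = cong₂ _∧ᵇ_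
  (evalF-agree F σ _ (agree-take (nlits F) σ s ag)) (evalF-agree G _ _ (agree-drop (nlits F) σ s ag))
evalF-agree (F ∨ G)   σ s        ag = cong₂ _∨ᵇ_
  (evalF-agree F σ _ (agree-take (nlits F) σ s ag)) (evalF-agree G _ _ (agree-drop (nlits F) σ s ag))

evalPool-agree : ∀ {k} (P : Vec Formula k) σ (s : Vec Bool (nlitsPool P)) → Agree σ s → evalPool P s ≡ evalPoolˢ P σ
evalPool-agree []      σ s ag = refl
evalPool-agree (F ∷ P) σ s ag = cong₂ _∷_
  (evalF-agree F σ _ (agree-take (nlits F) σ s ag)) (evalPool-agree P _ _ (agree-drop (nlits F) σ s ag))

truth-agree : ∀ C σ (s : Vec Bool (nlitsC C)) → Agree σ s → truthC C s ≡ truthˢ C σ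
truth-agree (cq k S P) σ s ag = cong (allGroups S) (evalPool-agree P σ s ag)

endpointsˢ-toℕ : ∀ {n} (A : List (Pair (Fin n))) → endpointsˢ (map (map-pair toℕ) A) ≡ map toℕ (endpoints A)
endpointsˢ-toℕ []            = refl
endpointsˢ-toℕ ((X , Y) ∷ A) = cong (λ l → toℕ X ∷ toℕ Y ∷ l) (endpointsˢ-toℕ A)

Trivial⇒Trivialˢ : ∀ C → Trivial C → Trivialˢ C
Trivial⇒Trivialˢ C (A , allocs , mono , trivializing) = trivialˢ
  (map (map-pair toℕ) A) (AllP.map⁺ (All.map allocation allocs))
  (subst Unique (sym (endpointsˢ-toℕ A)) (UniqueP.map⁺ FinP.toℕ-injective mono))
  trivializingˢ
  where
  lookupℕ-ports : ∀ X {p} → V.lookup (portsC C) X ≡ p → lookupℕ (portList C) (toℕ X) ≡ just p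
  lookupℕ-ports X e = subst (λ L → lookupℕ L (toℕ X) ≡ just _) (toList-portsC C)
                        (trans (lookupℕ-toList (portsC C) X) (cong just e))
  allocation : ∀ {XY} → IsAllocation (portsC C) XY → IsAllocationˢ (portList C) (map-pair toℕ XY)
  allocation {X , Y} (p , eX , eY) = p , lookupℕ-ports X eX , lookupℕ-ports Y eY
  trivializingˢ : ∀ σ → All (Respects σ) (map (map-pair toℕ) A) → truthˢ C σ ≡ true
  trivializingˢ σ respects = trans (sym (truth-agree C σ s agree)) (trivializing s consistent)
    where
    s : Vec Bool (nlitsC C)
    s = V.tabulate (λ i → σ (toℕ i))
    agree : Agree σ s
    agree i = sym (VP.lookup∘tabulate _ i)
    consistent : Consistent s A
    consistent = All.map (λ { {X , Y} r e → trans (VP.lookup∘tabulate _ Y) (r (trans (sym (VP.lookup∘tabulate _ X)) e)) })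
                         (AllP.map⁻ respects)

fromℕ-arrangement : ∀ {n} (ports : Vec Port n) (A : List (Pair ℕ)) → All (IsAllocationˢ (V.toList ports)) A →
  Σ (List (Pair (Fin n))) λ A′ → map (map-pair toℕ) A′ ≡ A × All (IsAllocation ports) A′
fromℕ-arrangement ports []            []                    = [] , refl , []
fromℕ-arrangement ports ((x , y) ∷ A) ((p , ex , ey) ∷ als)
  with lookupℕ-toList⁻ ports x ex | lookupℕ-toList⁻ ports y ey | fromℕ-arrangement ports A als
... | X , refl , lX | Y , refl , lY | A′ , refl , als′ = (X , Y) ∷ A′ , refl , (p , lX , lY) ∷ als′

Trivialˢ⇒Trivial : ∀ C → Trivialˢ C → Trivial C
Trivialˢ⇒Trivial C (trivialˢ A allocs unique trivializing)
  with fromℕ-arrangement (portsC C) A (subst (λ L → All (IsAllocationˢ L) A) (sym (toList-portsC C)) allocs)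
... | A′ , refl , allocs′ =
  A′ , allocs′ , UniqueP.map⁻ (subst Unique (endpointsˢ-toℕ A′) unique) ,
  λ s consistent → trans (truth-agree C (stream s) s (stream-toℕ s)) (trivializing (stream s) (respects s consistent))
  where
  respects : ∀ s → Consistent s A′ → All (Respects (stream s)) (map (map-pair toℕ) A′)
  respects s c = AllP.map⁺ (All.map (λ { {X , Y} r e → trans (stream-toℕ s Y) (r (trans (sym (stream-toℕ s X)) e)) }) c)

lookupℕ-++ʳ : ∀ {X : Set} (xs ys : List X) i → lookupℕ (xs ++ˡ ys) (L.length xs + i) ≡ lookupℕ ys i
lookupℕ-++ʳ []       ys i = refl
lookupℕ-++ʳ (x ∷ xs) ys i = lookupℕ-++ʳ xs ys i

lookupℕ-++ˡ : ∀ {X : Set} (xs ys : List X) i {v} → lookupℕ xs i ≡ just v → lookupℕ (xs ++ˡ ys) i ≡ just v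
lookupℕ-++ˡ (x ∷ xs) ys zero    e = e
lookupℕ-++ˡ (x ∷ xs) ys (suc i) e = lookupℕ-++ˡ xs ys i e

lookupℕ-< : ∀ {X : Set} (xs : List X) i {v} → lookupℕ xs i ≡ just v → i < L.length xs
lookupℕ-< (x ∷ xs) zero    e = s≤s z≤n
lookupℕ-< (x ∷ xs) (suc i) e = s≤s (lookupℕ-< xs i e)

lookupℕ-++⁻ : ∀ {X : Set} (xs ys : List X) i {v} → lookupℕ (xs ++ˡ ys) i ≡ just v →
  lookupℕ xs i ≡ just v ⊎ Σ ℕ λ j → i ≡ L.length xs + j × lookupℕ ys j ≡ just v
lookupℕ-++⁻ []       ys i       e = inj₂ (i , refl , e)
lookupℕ-++⁻ (x ∷ xs) ys zero    e = inj₁ e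
lookupℕ-++⁻ (x ∷ xs) ys (suc i) e with lookupℕ-++⁻ xs ys i e
... | inj₁ e′               = inj₁ e′
... | inj₂ (j , refl , e′) = inj₂ (j , refl , e′)

length-portListF : ∀ F → L.length (portListF F) ≡ nlits F
length-portListF (atom p)  = refl
length-portListF (natom p) = refl
length-portListF (F ∧ G)   = trans (LP.length-++ (portListF F)) (cong₂ _+_ (length-portListF F) (length-portListF G))
length-portListF (F ∨ G)   = trans (LP.length-++ (portListF F)) (cong₂ _+_ (length-portListF F) (length-portListF G))

length-portListPool : ∀ {k} (P : Vec Formula k) → L.length (portListPool P) ≡ nlitsPool P
length-portListPool []      = refl
length-portListPool (F ∷ P) = trans (LP.length-++ (portListF F)) (cong₂ _+_ (length-portListF F) (length-portListPool P))

lookupℕ-portListF-++ʳ : ∀ F (ys : List Port) i → lookupℕ (portListF F ++ˡ ys) (nlits F + i) ≡ lookupℕ ys i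
lookupℕ-portListF-++ʳ F ys i =
  subst (λ n → lookupℕ (portListF F ++ˡ ys) (n + i) ≡ _) (length-portListF F) (lookupℕ-++ʳ (portListF F) ys i)

lookupℕ-portListF-++⁻ : ∀ F (ys : List Port) i {v} → lookupℕ (portListF F ++ˡ ys) i ≡ just v →
  (i < nlits F × lookupℕ (portListF F) i ≡ just v) ⊎ Σ ℕ λ j → i ≡ nlits F + j × lookupℕ ys j ≡ just v
lookupℕ-portListF-++⁻ F ys i e with lookupℕ-++⁻ (portListF F) ys i e
... | inj₁ e′               = inj₁ (subst (i <_) (length-portListF F) (lookupℕ-< (portListF F) i e′) , e′)
... | inj₂ (j , refl , e′) = inj₂ (j , cong (_+ j) (length-portListF F) , e′)

evalFˢ-cong< : ∀ F {σ τ} → (∀ i → i < nlits F → σ i ≡ τ i) → evalFˢ F σ ≡ evalFˢ F τ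
evalFˢ-cong< (atom p)  σ≗τ = σ≗τ 0 (s≤s z≤n)
evalFˢ-cong< (natom p) σ≗τ = cong not (σ≗τ 0 (s≤s z≤n))
evalFˢ-cong< (F ∧ G)   σ≗τ = cong₂ _∧ᵇ_
  (evalFˢ-cong< F (λ i i< → σ≗τ i (≤-trans i< (m≤m+n _ _))))
  (evalFˢ-cong< G (λ i i< → σ≗τ (nlits F + i) (+-monoʳ-< (nlits F) i<)))
evalFˢ-cong< (F ∨ G)   σ≗τ = cong₂ _∨ᵇ_
  (evalFˢ-cong< F (λ i i< → σ≗τ i (≤-trans i< (m≤m+n _ _))))
  (evalFˢ-cong< G (λ i i< → σ≗τ (nlits F + i) (+-monoʳ-< (nlits F) i<)))

evalFˢ-cong : ∀ F {σ τ} → (∀ i → σ i ≡ τ i) → evalFˢ F σ ≡ evalFˢ F τ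
evalFˢ-cong F σ≗τ = evalFˢ-cong< F (λ i _ → σ≗τ i)

evalPoolˢ-cong : ∀ {k} (P : Vec Formula k) {σ τ} → (∀ i → σ i ≡ τ i) → evalPoolˢ P σ ≡ evalPoolˢ P τ
evalPoolˢ-cong []      σ≗τ = refl
evalPoolˢ-cong (F ∷ P) σ≗τ = cong₂ _∷_ (evalFˢ-cong F σ≗τ) (evalPoolˢ-cong P (λ i → σ≗τ (nlits F + i)))

endpointsˢ-map : ∀ π A → endpointsˢ (map (map-pair π) A) ≡ map π (endpointsˢ A)
endpointsˢ-map π []            = refl
endpointsˢ-map π ((x , y) ∷ A) = cong (λ l → π x ∷ π y ∷ l) (endpointsˢ-map π A)

Trivialˢ-rename : ∀ {C₁ C₂} (π : ℕ → ℕ) → (∀ {x y} → π x ≡ π y → x ≡ y) →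
  (∀ x {v} → lookupℕ (portList C₁) x ≡ just v → lookupℕ (portList C₂) (π x) ≡ just v) →
  (∀ σ → truthˢ C₁ (σ ∘ π) ≡ true → truthˢ C₂ σ ≡ true) → Trivialˢ C₁ → Trivialˢ C₂
Trivialˢ-rename π π-injective π-ports C₁⇒C₂ (trivialˢ A allocs unique trivializing) = trivialˢ
  (map (map-pair π) A)
  (AllP.map⁺ (All.map (λ { {x , y} (p , ex , ey) → p , π-ports x ex , π-ports y ey }) allocs))
  (subst Unique (sym (endpointsˢ-map π A)) (UniqueP.map⁺ π-injective unique))
  (λ σ respects → C₁⇒C₂ σ (trivializing (σ ∘ π) (AllP.map⁻ respects)))

Trivialˢ-mono : ∀ {C₁ C₂} → portList C₁ ≡ portList C₂ →
  (∀ σ → truthˢ C₁ σ ≡ true → truthˢ C₂ σ ≡ true) → Trivialˢ C₁ → Trivialˢ C₂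
Trivialˢ-mono ports C₁⇒C₂ (trivialˢ A allocs unique trivializing) =
  trivialˢ A (subst (λ L → All (IsAllocationˢ L) A) ports allocs) unique (λ σ r → C₁⇒C₂ σ (trivializing σ r))

GroupTrue : ∀ {k} → Vec Bool k → Subset k → Set
GroupTrue w Γ = evalGroup Γ w ≡ true

allGroups-true⁻ : ∀ {k} (S : List (Subset k)) w → allGroups S w ≡ true → All (GroupTrue w) S
allGroups-true⁻ []      w e = []
allGroups-true⁻ (Γ ∷ S) w e = proj₁ (∧-true⁻ _ _ e) ∷ allGroups-true⁻ S w (proj₂ (∧-true⁻ _ _ e))

allGroups-true⁺ : ∀ {k} (S : List (Subset k)) w → All (GroupTrue w) S → allGroups S w ≡ true
allGroups-true⁺ []      w []      = refl
allGroups-true⁺ (Γ ∷ S) w (e ∷ a) rewrite e = allGroups-true⁺ S w a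

Trivialˢ-regroup : ∀ {k} {P : Vec Formula k} (S S′ : List (Subset k)) →
  (∀ w → All (GroupTrue w) S → All (GroupTrue w) S′) → Trivialˢ (cq k S P) → Trivialˢ (cq k S′ P)
Trivialˢ-regroup S S′ S⇒S′ = Trivialˢ-mono refl λ σ e → allGroups-true⁺ S′ _ (S⇒S′ _ (allGroups-true⁻ S _ e))

All-++-middle : ∀ {X : Set} {Q : X → Set} xs {ys zs : List X} →
  (All Q ys → All Q zs) → All Q (xs ++ˡ ys) → All Q (xs ++ˡ zs)
All-++-middle xs ys⇒zs a = AllP.++⁺ (AllP.++⁻ˡ xs a) (ys⇒zs (AllP.++⁻ʳ xs a))

evalGroup-[]≔inside : ∀ {k} (Γ : Subset k) (i : Fin k) w → GroupTrue w Γ → GroupTrue w (Γ [ i ]≔ inside)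
evalGroup-[]≔inside (g ∷ Γ) Fin.zero    (x ∷ w) e = ∨-monoˡ-true (evalGroup Γ w) (proj₂ ∘ ∧-true⁻ g x) e
evalGroup-[]≔inside (g ∷ Γ) (Fin.suc i) (x ∷ w) e with g ∧ᵇ x
... | true  = refl
... | false = evalGroup-[]≔inside Γ i w e

evalGroup-∪ : ∀ {k} (Γ Δ : Subset k) w → evalGroup (Γ ∪ Δ) w ≡ evalGroup Γ w ∨ᵇ evalGroup Δ w
evalGroup-∪ []      []      []      = refl
evalGroup-∪ (g ∷ Γ) (d ∷ Δ) (x ∷ w) = trans (cong (((g ∨ᵇ d) ∧ᵇ x) ∨ᵇ_) (evalGroup-∪ Γ Δ w))
  (∧-distribʳ-∨-interchange g d x _ _)

evalGroupExcept : ∀ a {b} → Subset (a + suc (suc b)) → Vec Bool (a + suc (suc b)) → Bool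
evalGroupExcept zero    (_ ∷ _ ∷ Γ) (_ ∷ _ ∷ w) = evalGroup Γ w
evalGroupExcept (suc a) (g ∷ Γ)     (x ∷ w)     = (g ∧ᵇ x) ∨ᵇ evalGroupExcept a Γ w

evalGroup-adjacent : ∀ a {b} (Γ : Subset (a + suc (suc b))) w {u v} → fstOf a Γ ≡ u → sndOf a Γ ≡ v →
  evalGroup Γ w ≡ (u ∧ᵇ fstOf a w) ∨ᵇ ((v ∧ᵇ sndOf a w) ∨ᵇ evalGroupExcept a Γ w)
evalGroup-adjacent zero    (_ ∷ _ ∷ Γ) (_ ∷ _ ∷ w) refl refl = refl
evalGroup-adjacent (suc a) (g ∷ Γ)     (x ∷ w)     refl refl =
  trans (cong ((g ∧ᵇ x) ∨ᵇ_) (evalGroup-adjacent a Γ w refl refl))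
  (∨-left-rotate (g ∧ᵇ x) (fstOf a Γ ∧ᵇ fstOf a w) (sndOf a Γ ∧ᵇ sndOf a w) (evalGroupExcept a Γ w))

evalGroup-mergeWith : ∀ a {b} f h (Γ : Subset (a + suc (suc b))) w {u v} → fstOf a Γ ≡ u → sndOf a Γ ≡ v →
  evalGroup (mergeWith a f Γ) (mergeWith a h w) ≡ (f u v ∧ᵇ h (fstOf a w) (sndOf a w)) ∨ᵇ evalGroupExcept a Γ w
evalGroup-mergeWith zero    f h (_ ∷ _ ∷ Γ) (_ ∷ _ ∷ w) refl refl = refl
evalGroup-mergeWith (suc a) f h (g ∷ Γ)     (x ∷ w)     refl refl =
  trans (cong ((g ∧ᵇ x) ∨ᵇ_) (evalGroup-mergeWith a f h Γ w refl refl))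
  (∨-left-swap (g ∧ᵇ x) (f (fstOf a Γ) (sndOf a Γ) ∧ᵇ h (fstOf a w) (sndOf a w)) (evalGroupExcept a Γ w))

evalGroupExcept-∪ : ∀ a {b} (Γ Δ : Subset (a + suc (suc b))) w →
  evalGroupExcept a (Γ ∪ Δ) w ≡ evalGroupExcept a Γ w ∨ᵇ evalGroupExcept a Δ w
evalGroupExcept-∪ zero    (_ ∷ _ ∷ Γ) (_ ∷ _ ∷ Δ) (_ ∷ _ ∷ w) = evalGroup-∪ Γ Δ w
evalGroupExcept-∪ (suc a) (g ∷ Γ)     (d ∷ Δ)     (x ∷ w)     =
  trans (cong (((g ∨ᵇ d) ∧ᵇ x) ∨ᵇ_) (evalGroupExcept-∪ a Γ Δ w))
    (∧-distribʳ-∨-interchange g d x _ _)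

fstOf-∪ : ∀ a {b} (Γ Δ : Subset (a + suc (suc b))) → fstOf a (Γ ∪ Δ) ≡ fstOf a Γ ∨ᵇ fstOf a Δ
fstOf-∪ zero    (_ ∷ _ ∷ _) (_ ∷ _ ∷ _) = refl
fstOf-∪ (suc a) (_ ∷ Γ)     (_ ∷ Δ)     = fstOf-∪ a Γ Δ

data Connective : Set where
  and or : Connective

connect : Connective → Formula → Formula → Formula
connect and = _∧_
connect or  = _∨_

boolOp : Connective → Bool → Bool → Bool
boolOp and = _∧ᵇ_
boolOp or  = _∨ᵇ_

nlits-connect : ∀ c F G → nlits (connect c F G) ≡ nlits F + nlits G
nlits-connect and F G = refl
nlits-connect or  F G = refl

evalFˢ-connect : ∀ c F G σ → evalFˢ (connect c F G) σ ≡ boolOp c (evalFˢ F σ) (evalFˢ G (shift (nlits F) σ))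
evalFˢ-connect and F G σ = refl
evalFˢ-connect or  F G σ = refl

portListF-connect : ∀ c F G → portListF (connect c F G) ≡ portListF F ++ˡ portListF G
portListF-connect and F G = refl
portListF-connect or  F G = refl

evalPoolˢ-mergeWith : ∀ a {b} c (P : Vec Formula (a + suc (suc b))) σ →
  evalPoolˢ (mergeWith a (connect c) P) σ ≡ mergeWith a (boolOp c) (evalPoolˢ P σ)
evalPoolˢ-mergeWith zero    c (F ∷ G ∷ R) σ = cong₂ _∷_ (evalFˢ-connect c F G σ)
  (evalPoolˢ-cong R (λ i → cong σ (trans (cong (_+ i) (nlits-connect c F G)) (+-assoc (nlits F) (nlits G) i))))
evalPoolˢ-mergeWith (suc a) c (F ∷ P)     σ = cong (evalFˢ F σ ∷_) (evalPoolˢ-mergeWith a c P _)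

portListPool-mergeWith : ∀ a {b} c (P : Vec Formula (a + suc (suc b))) →
  portListPool (mergeWith a (connect c) P) ≡ portListPool P
portListPool-mergeWith zero    c (F ∷ G ∷ R) =
  trans (cong (_++ˡ portListPool R) (portListF-connect c F G)) (LP.++-assoc (portListF F) (portListF G) (portListPool R))
portListPool-mergeWith (suc a) c (F ∷ P)     = cong (portListF F ++ˡ_) (portListPool-mergeWith a c P)

Trivialˢ-mergeWith : ∀ a {b} c {S : List (Subset (a + suc (suc b)))} {P} S′ →
  (∀ w → All (GroupTrue w) S → All (GroupTrue (mergeWith a (boolOp c) w)) S′) →
  Trivialˢ (cq _ S P) → Trivialˢ (cq _ S′ (mergeWith a (connect c) P))
Trivialˢ-mergeWith a c {S} {P} S′ S⇒S′ = Trivialˢ-mono (sym (portListPool-mergeWith a c P)) truth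
  where
  truth : ∀ σ → truthˢ (cq _ S P) σ ≡ true → truthˢ (cq _ S′ (mergeWith a (connect c) P)) σ ≡ true
  truth σ e = subst (λ w → allGroups S′ w ≡ true) (sym (evalPoolˢ-mergeWith a c P σ))
                (allGroups-true⁺ S′ _ (S⇒S′ _ (allGroups-true⁻ S _ e)))

Trivialˢ-unmergeWith : ∀ a {b} c (S : List (Subset (a + suc b))) {S′ : List (Subset (a + suc (suc b)))} {P} →
  (∀ w → All (GroupTrue (mergeWith a (boolOp c) w)) S → All (GroupTrue w) S′) →
  Trivialˢ (cq _ S (mergeWith a (connect c) P)) → Trivialˢ (cq _ S′ P)
Trivialˢ-unmergeWith a c S {S′} {P} S⇒S′ = Trivialˢ-mono (portListPool-mergeWith a c P) truth
  where
  truth : ∀ σ → truthˢ (cq _ S (mergeWith a (connect c) P)) σ ≡ true → truthˢ (cq _ S′ P) σ ≡ true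
  truth σ e = allGroups-true⁺ S′ _ (S⇒S′ _ (allGroups-true⁻ S _
                (subst (λ w → allGroups S w ≡ true) (evalPoolˢ-mergeWith a c P σ) e)))

-- AndCondition a S, in the inductive form in which pairUnion a consumes S.
data AndPaired (a : ℕ) {b : ℕ} : List (Subset (a + suc (suc b))) → Set where
  []   : AndPaired a []
  skip : ∀ {Γ S} → fstOf a Γ ≡ false → sndOf a Γ ≡ false → AndPaired a S → AndPaired a (Γ ∷ S)
  pair : ∀ {Γ Δ S} → fstOf a Γ ≡ true → sndOf a Γ ≡ false → fstOf a Δ ≡ false → sndOf a Δ ≡ true →
         AndPaired a S → AndPaired a (Γ ∷ Δ ∷ S)

pairUnion-skip : ∀ a {b} (Γ : Subset (a + suc (suc b))) S → fstOf a Γ ≡ false →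
  pairUnion a (Γ ∷ S) ≡ Γ ∷ pairUnion a S
pairUnion-skip a Γ []      _ = refl
pairUnion-skip a Γ (_ ∷ _) e rewrite e = refl

pairUnion-pair : ∀ a {b} (Γ Δ : Subset (a + suc (suc b))) S → fstOf a Γ ≡ true →
  pairUnion a (Γ ∷ Δ ∷ S) ≡ (Γ ∪ Δ) ∷ pairUnion a S
pairUnion-pair a Γ Δ S e rewrite e = refl

Followed : ∀ a {b} → List (Subset (a + suc (suc b))) → Set
Followed a S = ∀ xs Γ ys → S ≡ xs ++ˡ (Γ ∷ ys) → fstOf a Γ ≡ true →
  Σ _ λ Δ → Σ _ λ ys′ → ys ≡ Δ ∷ ys′ × sndOf a Δ ≡ true

Preceded : ∀ a {b} → List (Subset (a + suc (suc b))) → Set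
Preceded a S = ∀ xs Γ ys → S ≡ xs ++ˡ (Γ ∷ ys) → sndOf a Γ ≡ true →
  Σ _ λ xs′ → Σ _ λ Δ → xs ≡ xs′ ∷ʳ Δ × fstOf a Δ ≡ true

snoc-split : ∀ {X : Set} ys (y : X) xs xs′ z → ys ++ˡ (y ∷ xs) ≡ xs′ ∷ʳ z →
  (xs ≡ [] × y ≡ z) ⊎ Σ (List X) λ xs″ → xs ≡ xs″ ∷ʳ z
snoc-split []       y xs       []        z refl = inj₁ (refl , refl)
snoc-split []       y xs       (x ∷ xs′) z e    = inj₂ (xs′ , LP.∷-injectiveʳ e)
snoc-split (_ ∷ ys) y xs       []        z e    with LP.∷-injectiveʳ e
snoc-split (_ ∷ []) y xs       []        z e | ()
snoc-split (_ ∷ _ ∷ ys) y xs   []        z e | ()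
snoc-split (_ ∷ ys) y xs       (_ ∷ xs′) z e    = snoc-split ys y xs xs′ z (LP.∷-injectiveʳ e)

Followed-drop : ∀ a {b} ys {S : List (Subset (a + suc (suc b)))} → Followed a (ys ++ˡ S) → Followed a S
Followed-drop a ys followed xs Γ zs refl = followed (ys ++ˡ xs) Γ zs (sym (LP.++-assoc ys xs (Γ ∷ zs)))

-- The first group of S would be preceded by Γ, which the hypothesis on Γ excludes.
Preceded-drop : ∀ a {b} ys {Γ} {S : List (Subset (a + suc (suc b)))} → fstOf a Γ ≡ false →
  Preceded a (ys ++ˡ (Γ ∷ S)) → Preceded a S
Preceded-drop a ys {Γ} fΓ preceded xs Δ zs refl sΔ
  with preceded (ys ++ˡ (Γ ∷ xs)) Δ zs (sym (LP.++-assoc ys (Γ ∷ xs) (Δ ∷ zs))) sΔ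
... | xs′ , Δ′ , e , fΔ′ with snoc-split ys Γ xs xs′ Δ′ e
...   | inj₁ (_ , refl)     = ⊥-elim (false≢true (trans (sym fΓ) fΔ′))
...   | inj₂ (xs″ , refl) = xs″ , Δ′ , refl , fΔ′

AndCondition⇒AndPaired : ∀ a {b} (S : List (Subset (a + suc (suc b)))) → AndCondition a S → AndPaired a S
AndCondition⇒AndPaired a [] _ = []
AndCondition⇒AndPaired a (Γ ∷ S) (notBoth ∷ notBoths , followed , preceded) with sndOf a Γ in sΓ | fstOf a Γ in fΓ
... | true  | _ with preceded [] Γ S refl sΓ
...   | []      , _ , () , _
...   | _ ∷ _   , _ , () , _
AndCondition⇒AndPaired a (Γ ∷ S) (notBoth ∷ notBoths , followed , preceded) | false | false =
  skip fΓ sΓ (AndCondition⇒AndPaired a S (notBoths , Followed-drop a (Γ ∷ []) followed , Preceded-drop a [] fΓ preceded))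
AndCondition⇒AndPaired a (Γ ∷ S) (notBoth ∷ notBoths , followed , preceded) | false | true
  with followed [] Γ S refl fΓ
... | Δ , S′ , refl , sΔ with notBoths
...   | notBothΔ ∷ notBoths′ with fstOf a Δ in fΔ
...     | true  = ⊥-elim (notBothΔ (refl , sΔ))
...     | false = pair fΓ sΓ fΔ sΔ
    (AndCondition⇒AndPaired a S′
      (notBoths′ , Followed-drop a (Γ ∷ Δ ∷ []) followed , Preceded-drop a (Γ ∷ []) fΔ preceded))

AndPaired⇒AndCondition : ∀ a {b} {S : List (Subset (a + suc (suc b)))} → AndPaired a S → AndCondition a S
AndPaired⇒AndCondition a paired = notBoth paired , followed paired , preceded paired
  where
  notBoth : ∀ {S} → AndPaired a S → All (λ Γ → ¬ (fstOf a Γ ≡ true × sndOf a Γ ≡ true)) S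
  notBoth []                    = []
  notBoth (skip f _ p)          = (λ (f′ , _) → false≢true (trans (sym f) f′)) ∷ notBoth p
  notBoth (pair _ sΓ fΔ _ p)    = (λ (_ , s′) → false≢true (trans (sym sΓ) s′))
                                  ∷ (λ (f′ , _) → false≢true (trans (sym fΔ) f′)) ∷ notBoth p
  followed : ∀ {S} → AndPaired a S → Followed a S
  followed []                   []          _ _ ()
  followed []                   (_ ∷ _)     _ _ ()
  followed (skip f _ p)         []          _ _ refl f′ = ⊥-elim (false≢true (trans (sym f) f′))
  followed (skip _ _ p)         (_ ∷ xs)    Γ ys refl f′ = followed p xs Γ ys refl f′
  followed (pair _ _ _ sΔ p)    []          _ _ refl _  = _ , _ , refl , sΔ
  followed (pair _ _ fΔ _ p)    (_ ∷ [])    _ _ refl f′ = ⊥-elim (false≢true (trans (sym fΔ) f′))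
  followed (pair _ _ _ _ p)     (_ ∷ _ ∷ xs) Γ ys refl f′ = followed p xs Γ ys refl f′
  preceded : ∀ {S} → AndPaired a S → Preceded a S
  preceded []                   []          _ _ ()
  preceded []                   (_ ∷ _)     _ _ ()
  preceded (skip _ s p)         []          _ _ refl s′ = ⊥-elim (false≢true (trans (sym s) s′))
  preceded (skip _ _ p)         (x ∷ xs)    Γ ys refl s′ with preceded p xs Γ ys refl s′
  ... | xs′ , Δ , refl , fΔ = x ∷ xs′ , Δ , refl , fΔ
  preceded (pair _ sΓ _ _ p)    []          _ _ refl s′ = ⊥-elim (false≢true (trans (sym sΓ) s′))
  preceded (pair fΓ _ _ _ p)    (x ∷ [])    _ _ refl _  = [] , x , refl , fΓ
  preceded (pair _ _ _ _ p)     (x ∷ y ∷ xs) Γ ys refl s′ with preceded p xs Γ ys refl s′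
  ... | xs′ , Δ , refl , fΔ = x ∷ y ∷ xs′ , Δ , refl , fΔ

evalGroup-pairUnion : ∀ a {b} {S : List (Subset (a + suc (suc b)))} w → AndPaired a S → All (GroupTrue w) S →
  All (GroupTrue (mergeWith a _∧ᵇ_ w)) (map (mergeWith a _∨ᵇ_) (pairUnion a S))
evalGroup-pairUnion a w [] [] = []
evalGroup-pairUnion a w (skip {Γ} {S} fΓ sΓ p) (g ∷ gs) rewrite pairUnion-skip a Γ S fΓ =
  trans (evalGroup-mergeWith a _∨ᵇ_ _∧ᵇ_ Γ w fΓ sΓ) (trans (sym (evalGroup-adjacent a Γ w fΓ sΓ)) g)
  ∷ evalGroup-pairUnion a w p gs
evalGroup-pairUnion a w (pair {Γ} {Δ} {S} fΓ sΓ fΔ sΔ p) (gΓ ∷ gΔ ∷ gs) rewrite pairUnion-pair a Γ Δ S fΓ =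
  trans (evalGroup-mergeWith a _∨ᵇ_ _∧ᵇ_ (Γ ∪ Δ) w (trans (fstOf-∪ a Γ Δ) (cong (_∨ᵇ fstOf a Δ) fΓ)) refl)
    (trans (cong ((fstOf a w ∧ᵇ sndOf a w) ∨ᵇ_) (evalGroupExcept-∪ a Γ Δ w))
      (merge-∧-true (fstOf a w) (sndOf a w) _ _ (trans (sym (evalGroup-adjacent a Γ w fΓ sΓ)) gΓ)
                                                (trans (sym (evalGroup-adjacent a Δ w fΔ sΔ)) gΔ)))
  ∷ evalGroup-pairUnion a w p gs

blockSwap : ℕ → ℕ → ℕ → ℕ
blockSwap p q i with i <? p
... | yes _ = q + i
... | no _ with i <? p + q
...   | yes _ = i ∸ p
...   | no _  = i

blockSwap-first : ∀ p q i → i < p → blockSwap p q i ≡ q + i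
blockSwap-first p q i i<p with i <? p
... | yes _   = refl
... | no i≮p = ⊥-elim (i≮p i<p)

blockSwap-second : ∀ p q j → j < q → blockSwap p q (p + j) ≡ j
blockSwap-second p q j j<q with p + j <? p
... | yes p+j<p = ⊥-elim (m+n≮m p j p+j<p)
... | no _ with p + j <? p + q
...   | yes _      = m+n∸m≡n p j
...   | no p+j≮p+q = ⊥-elim (p+j≮p+q (+-monoʳ-< p j<q))

blockSwap-rest : ∀ p q r → blockSwap p q (p + (q + r)) ≡ p + (q + r)
blockSwap-rest p q r with p + (q + r) <? p
... | yes lt = ⊥-elim (m+n≮m p (q + r) lt)
... | no _ with p + (q + r) <? p + q
...   | yes lt = ⊥-elim (m+n≮m (p + q) r (subst (_< p + q) (sym (+-assoc p q r)) lt))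
...   | no _   = refl

+-left-swap : ∀ p q r → p + (q + r) ≡ q + (p + r)
+-left-swap p q r = trans (sym (+-assoc p q r)) (trans (cong (_+ r) (+-comm p q)) (+-assoc q p r))

data Block (p : ℕ) : ℕ → Set where
  below  : ∀ {i} → i < p → Block p i
  beyond : ∀ j → Block p (p + j)

block : ∀ p i → Block p i
block zero    i       = beyond i
block (suc p) zero    = below (s≤s z≤n)
block (suc p) (suc i) with block p i
... | below i<p = below (s≤s i<p)
... | beyond j  = beyond j

blockSwap-inverse : ∀ p q i → blockSwap q p (blockSwap p q i) ≡ i
blockSwap-inverse p q i with block p i
... | below i<p = trans (cong (blockSwap q p) (blockSwap-first p q i i<p)) (blockSwap-second q p i i<p)
... | beyond j with block q j
...   | below j<q = trans (cong (blockSwap q p) (blockSwap-second p q j j<q)) (blockSwap-first q p j j<q)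
...   | beyond r  = begin
  blockSwap q p (blockSwap p q (p + (q + r))) ≡⟨ cong (blockSwap q p) (trans (blockSwap-rest p q r) (+-left-swap p q r)) ⟩
  blockSwap q p (q + (p + r))                 ≡⟨ blockSwap-rest q p r ⟩
  q + (p + r)                                 ≡⟨ +-left-swap q p r ⟩
  p + (q + r)                                 ∎
  where open ≡-Reasoning

above : ℕ → (ℕ → ℕ) → ℕ → ℕ
above zero    π i       = π i
above (suc o) π zero    = zero
above (suc o) π (suc i) = suc (above o π i)

above-+ : ∀ n o π i → above (n + o) π (n + i) ≡ n + above o π i
above-+ zero    o π i = refl
above-+ (suc n) o π i = cong suc (above-+ n o π i)

above-< : ∀ n o π i → i < n → above (n + o) π i ≡ i
above-< (suc n) o π zero    _         = refl
above-< (suc n) o π (suc i) (s≤s i<n) = cong suc (above-< n o π i i<n)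

above-inverse : ∀ o π π′ → (∀ i → π′ (π i) ≡ i) → ∀ i → above o π′ (above o π i) ≡ i
above-inverse zero    π π′ inv i       = inv i
above-inverse (suc o) π π′ inv zero    = refl
above-inverse (suc o) π π′ inv (suc i) = cong suc (above-inverse o π π′ inv i)

offsetOf : ∀ a {b} → Vec Formula (a + suc (suc b)) → ℕ
offsetOf zero    _       = 0
offsetOf (suc a) (F ∷ P) = nlits F + offsetOf a P

exchangeRenaming : ∀ a {b} → Vec Formula (a + suc (suc b)) → ℕ → ℕ
exchangeRenaming a P = above (offsetOf a P) (blockSwap (nlits (fstOf a P)) (nlits (sndOf a P)))

exchangeRenaming-injective : ∀ a {b} (P : Vec Formula (a + suc (suc b))) {x y} →
  exchangeRenaming a P x ≡ exchangeRenaming a P y → x ≡ y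
exchangeRenaming-injective a P {x} {y} e = begin
  x                                     ≡⟨ sym (inverse x) ⟩
  above o (blockSwap q p) (above o π x) ≡⟨ cong (above o (blockSwap q p)) e ⟩
  above o (blockSwap q p) (above o π y) ≡⟨ inverse y ⟩
  y                                     ∎
  where
  open ≡-Reasoning
  o p q : ℕ
  o = offsetOf a P
  p = nlits (fstOf a P)
  q = nlits (sndOf a P)
  π : ℕ → ℕ
  π = blockSwap p q
  inverse : ∀ i → above o (blockSwap q p) (above o π i) ≡ i
  inverse = above-inverse o π (blockSwap q p) (blockSwap-inverse p q)

lookupℕ-exchange : ∀ a {b} (P : Vec Formula (a + suc (suc b))) x {v} → lookupℕ (portListPool P) x ≡ just v →
  lookupℕ (portListPool (swapAdj a P)) (exchangeRenaming a P x) ≡ just v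
lookupℕ-exchange zero (F ∷ G ∷ R) x e with lookupℕ-portListF-++⁻ F (portListF G ++ˡ portListPool R) x e
... | inj₁ (x<F , eF) rewrite blockSwap-first (nlits F) (nlits G) x x<F =
  trans (lookupℕ-portListF-++ʳ G _ x) (lookupℕ-++ˡ (portListF F) (portListPool R) x eF)
... | inj₂ (j , refl , e′) with lookupℕ-portListF-++⁻ G (portListPool R) j e′
...   | inj₁ (j<G , eG) rewrite blockSwap-second (nlits F) (nlits G) j j<G = lookupℕ-++ˡ (portListF G) _ j eG
...   | inj₂ (r , refl , eR) rewrite blockSwap-rest (nlits F) (nlits G) r | +-left-swap (nlits F) (nlits G) r =
  trans (lookupℕ-portListF-++ʳ G _ (nlits F + r)) (trans (lookupℕ-portListF-++ʳ F _ r) eR)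
lookupℕ-exchange (suc a) (F ∷ P) x e with lookupℕ-portListF-++⁻ F (portListPool P) x e
... | inj₁ (x<F , eF) rewrite above-< (nlits F) (offsetOf a P) (blockSwap (nlits (fstOf a P)) (nlits (sndOf a P))) x x<F =
  lookupℕ-++ˡ (portListF F) _ x eF
... | inj₂ (j , refl , e′) rewrite above-+ (nlits F) (offsetOf a P) (blockSwap (nlits (fstOf a P)) (nlits (sndOf a P))) j =
  trans (lookupℕ-portListF-++ʳ F _ _) (lookupℕ-exchange a P j e′)

evalPoolˢ-exchange : ∀ a {b} (P : Vec Formula (a + suc (suc b))) σ →
  evalPoolˢ (swapAdj a P) σ ≡ swapAdj a (evalPoolˢ P (σ ∘ exchangeRenaming a P))
evalPoolˢ-exchange zero (F ∷ G ∷ R) σ = cong₂ _∷_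
  (evalFˢ-cong< G (λ i i<G → cong σ (sym (blockSwap-second (nlits F) (nlits G) i i<G))))
  (cong₂ _∷_ (evalFˢ-cong< F (λ i i<F → cong σ (sym (blockSwap-first (nlits F) (nlits G) i i<F))))
    (evalPoolˢ-cong R (λ i → cong σ (trans (+-left-swap (nlits G) (nlits F) i) (sym (blockSwap-rest (nlits F) (nlits G) i))))))
evalPoolˢ-exchange (suc a) (F ∷ P) σ = cong₂ _∷_
  (evalFˢ-cong< F (λ i i<F → cong σ (sym (above-< (nlits F) (offsetOf a P) π i i<F))))
  (trans (evalPoolˢ-exchange a P (shift (nlits F) σ))
    (cong (swapAdj a) (evalPoolˢ-cong P (λ i → cong σ (sym (above-+ (nlits F) (offsetOf a P) π i))))))
  where
  π : ℕ → ℕ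
  π = blockSwap (nlits (fstOf a P)) (nlits (sndOf a P))

evalGroup-swapAdj : ∀ a {b} (Γ : Subset (a + suc (suc b))) w → evalGroup (swapAdj a Γ) (swapAdj a w) ≡ evalGroup Γ w
evalGroup-swapAdj zero    (g₁ ∷ g₂ ∷ Γ) (x₁ ∷ x₂ ∷ w) = ∨-left-swap (g₂ ∧ᵇ x₂) (g₁ ∧ᵇ x₁) (evalGroup Γ w)
evalGroup-swapAdj (suc a) (g ∷ Γ)       (x ∷ w)       = cong ((g ∧ᵇ x) ∨ᵇ_) (evalGroup-swapAdj a Γ w)

allGroups-swapAdj : ∀ a {b} (S : List (Subset (a + suc (suc b)))) w → allGroups (map (swapAdj a) S) (swapAdj a w) ≡ allGroups S w
allGroups-swapAdj a []      w = refl
allGroups-swapAdj a (Γ ∷ S) w = cong₂ _∧ᵇ_ (evalGroup-swapAdj a Γ w) (allGroups-swapAdj a S w)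

ExchangeClosed : (Cirquent → Set) → Set
ExchangeClosed Q = ∀ a {b} {S : List (Subset (a + suc (suc b)))} {P} →
  Q (cq _ S P) → Q (cq _ (map (swapAdj a) S) (swapAdj a P))

Trivialˢ-exch : ExchangeClosed Trivialˢ
Trivialˢ-exch a {S = S} {P} = Trivialˢ-rename (exchangeRenaming a P) (exchangeRenaming-injective a P) (lookupℕ-exchange a P)
  λ σ e → trans (cong (allGroups (map (swapAdj a) S)) (evalPoolˢ-exchange a P σ)) (trans (allGroups-swapAdj a S _) e)

swapAt : ∀ {X : Set} {k} → ℕ → Vec X k → Vec X k
swapAt zero    (x ∷ y ∷ v) = y ∷ x ∷ v
swapAt (suc a) (x ∷ v)     = x ∷ swapAt a v
swapAt _       v           = v

swapAt-swapAdj : ∀ {X : Set} a {b} (v : Vec X (a + suc (suc b))) → swapAt a v ≡ swapAdj a v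
swapAt-swapAdj zero    (x ∷ y ∷ v) = refl
swapAt-swapAdj (suc a) (x ∷ v)     = cong (x ∷_) (swapAt-swapAdj a v)

swapAt-short : ∀ {X : Set} {k} a (v : Vec X k) → k ≤ suc a → swapAt a v ≡ v
swapAt-short zero    []          _         = refl
swapAt-short zero    (x ∷ [])    _         = refl
swapAt-short zero    (x ∷ y ∷ v) (s≤s ())
swapAt-short (suc a) []          _         = refl
swapAt-short (suc a) (x ∷ v)     (s≤s k≤a) = cong (x ∷_) (swapAt-short a v k≤a)

length-cases : ∀ a k → (Σ ℕ λ b → k ≡ a + suc (suc b)) ⊎ k ≤ suc a
length-cases zero    zero          = inj₂ z≤n
length-cases zero    (suc zero)    = inj₂ (s≤s z≤n)
length-cases zero    (suc (suc b)) = inj₁ (b , refl)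
length-cases (suc a) zero          = inj₂ z≤n
length-cases (suc a) (suc k) with length-cases a k
... | inj₁ (b , refl) = inj₁ (b , refl)
... | inj₂ k≤a        = inj₂ (s≤s k≤a)

sink : ∀ {X : Set} {k} → ℕ → ℕ → Vec X k → Vec X k
sink o zero    v = v
sink o (suc n) v = sink (suc o) n (swapAt o v)

sink-∷ : ∀ {X : Set} {k} o n (x : X) (v : Vec X k) → sink (suc o) n (x ∷ v) ≡ x ∷ sink o n v
sink-∷ o zero    x v = refl
sink-∷ o (suc n) x v = sink-∷ (suc o) n x (swapAt o v)

sink-insertAt : ∀ {X : Set} {m} (y : X) (v : Vec X m) (j : Fin (suc m)) → sink 0 (toℕ j) (y ∷ v) ≡ insertAt v j y
sink-insertAt y v       Fin.zero    = refl
sink-insertAt y (x ∷ v) (Fin.suc j) = trans (sink-∷ 0 (toℕ j) x (y ∷ v)) (cong (x ∷_) (sink-insertAt y v j))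

sink₁-insertAt : ∀ {X : Set} {m} (x y : X) (v : Vec X m) (j : Fin (suc m)) →
  sink 1 (toℕ j) (x ∷ y ∷ v) ≡ x ∷ insertAt v j y
sink₁-insertAt x y v j = trans (sink-∷ 0 (toℕ j) x (y ∷ v)) (cong (x ∷_) (sink-insertAt y v j))

module _ {Q : Cirquent → Set} (Q-exch : ExchangeClosed Q) where

  swapAt-closed : ∀ a {k} {S : List (Subset k)} {P} → Q (cq k S P) → Q (cq k (map (swapAt a) S) (swapAt a P))
  swapAt-closed a {k} {S} {P} q with length-cases a k
  ... | inj₁ (b , refl) = subst₂ (λ S′ P′ → Q (cq k S′ P′))
    (LP.map-cong (λ v → sym (swapAt-swapAdj a v)) S) (sym (swapAt-swapAdj a P)) (Q-exch a q)
  ... | inj₂ k≤a        = subst₂ (λ S′ P′ → Q (cq k S′ P′))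
    (trans (sym (LP.map-id S)) (LP.map-cong (λ v → sym (swapAt-short a v k≤a)) S)) (sym (swapAt-short a P k≤a)) q

  sink-closed : ∀ o n {k} {S : List (Subset k)} {P} → Q (cq k S P) → Q (cq k (map (sink o n) S) (sink o n P))
  sink-closed o zero    {S = S} q = subst (λ S′ → Q (cq _ S′ _)) (sym (LP.map-id S)) q
  sink-closed o (suc n) {S = S} q =
    subst (λ S′ → Q (cq _ S′ _)) (sym (LP.map-∘ S)) (sink-closed (suc o) n (swapAt-closed o q))

Trivialˢ-exch-group : ∀ {k} (xs : List (Subset k)) Γ Δ ys {P} →
  Trivialˢ (cq k (xs ++ˡ (Γ ∷ Δ ∷ ys)) P) → Trivialˢ (cq k (xs ++ˡ (Δ ∷ Γ ∷ ys)) P)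
Trivialˢ-exch-group xs Γ Δ ys = Trivialˢ-regroup _ _ λ w → All-++-middle xs λ { (g ∷ d ∷ a) → d ∷ g ∷ a }

Trivialˢ-dup : ∀ {k} (xs : List (Subset k)) Γ ys {P} →
  Trivialˢ (cq k (xs ++ˡ (Γ ∷ ys)) P) → Trivialˢ (cq k (xs ++ˡ (Γ ∷ Γ ∷ ys)) P)
Trivialˢ-dup xs Γ ys = Trivialˢ-regroup _ _ λ w → All-++-middle xs λ { (g ∷ a) → g ∷ g ∷ a }

Trivialˢ-undup : ∀ {k} (xs : List (Subset k)) Γ ys {P} →
  Trivialˢ (cq k (xs ++ˡ (Γ ∷ Γ ∷ ys)) P) → Trivialˢ (cq k (xs ++ˡ (Γ ∷ ys)) P)
Trivialˢ-undup xs Γ ys = Trivialˢ-regroup _ _ λ w → All-++-middle xs λ { (g ∷ _ ∷ a) → g ∷ a }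

Trivialˢ-weak-group : ∀ {k} (xs : List (Subset k)) Γ ys (i : Fin k) {P} →
  Trivialˢ (cq k (xs ++ˡ (Γ ∷ ys)) P) → Trivialˢ (cq k (xs ++ˡ ((Γ [ i ]≔ inside) ∷ ys)) P)
Trivialˢ-weak-group xs Γ ys i =
  Trivialˢ-regroup _ _ λ w → All-++-middle xs λ { (g ∷ a) → evalGroup-[]≔inside Γ i w g ∷ a }

allGroups-outside∷ : ∀ {k} (S : List (Subset k)) b w → allGroups (map (outside ∷_) S) (b ∷ w) ≡ allGroups S w
allGroups-outside∷ []      b w = refl
allGroups-outside∷ (Γ ∷ S) b w = cong (evalGroup Γ w ∧ᵇ_) (allGroups-outside∷ S b w)

Trivialˢ-weak-head : ∀ {k} {S : List (Subset k)} {P} F →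
  Trivialˢ (cq k S P) → Trivialˢ (cq (suc k) (map (outside ∷_) S) (F ∷ P))
Trivialˢ-weak-head {S = S} F = Trivialˢ-rename (nlits F +_) (+-cancelˡ-≡ (nlits F) _ _)
  (λ x e → trans (lookupℕ-portListF-++ʳ F _ x) e) λ σ e → trans (allGroups-outside∷ S _ _) e

-- F is inserted in front and then moved to position i by exchanges.
Trivialˢ-weak-formula : ∀ {k} {S : List (Subset k)} {P} (i : Fin (suc k)) F →
  Trivialˢ (cq k S P) → Trivialˢ (cq (suc k) (map (λ Γ → insertAt Γ i outside) S) (insertAt P i F))
Trivialˢ-weak-formula {S = S} {P} i F t =
  subst₂ (λ S′ P′ → Trivialˢ (cq _ S′ P′))
    (trans (sym (LP.map-∘ {g = sink 0 (toℕ i)} {f = outside ∷_} S)) (LP.map-cong (λ Γ → sink-insertAt outside Γ i) S))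
    (sink-insertAt F P i)
    (sink-closed {Q = Trivialˢ} Trivialˢ-exch 0 (toℕ i) (Trivialˢ-weak-head F t))

Trivialˢ-or : ∀ a {b} {S : List (Subset (a + suc (suc b)))} {P} →
  Trivialˢ (cq _ S P) → Trivialˢ (cq _ (map (mergeWith a _∨ᵇ_) S) (mergeWith a _∨_ P))
Trivialˢ-or a {S = S} = Trivialˢ-mergeWith a or (map (mergeWith a _∨ᵇ_) S) λ w gs → AllP.map⁺ (All.map (merged w) gs)
  where
  merged : ∀ w {Γ} → GroupTrue w Γ → GroupTrue (mergeWith a _∨ᵇ_ w) (mergeWith a _∨ᵇ_ Γ)
  merged w {Γ} e = trans (evalGroup-mergeWith a _∨ᵇ_ _∨ᵇ_ Γ w refl refl)
    (merge-∨-true (fstOf a Γ) (sndOf a Γ) (fstOf a w) (sndOf a w) _ (trans (sym (evalGroup-adjacent a Γ w refl refl)) e))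

Trivialˢ-and : ∀ a {b} {S : List (Subset (a + suc (suc b)))} {P} → AndCondition a S →
  Trivialˢ (cq _ S P) → Trivialˢ (cq _ (map (mergeWith a _∨ᵇ_) (pairUnion a S)) (mergeWith a _∧_ P))
Trivialˢ-and a {S = S} condition =
  Trivialˢ-mergeWith a and _ λ w → evalGroup-pairUnion a w (AndCondition⇒AndPaired a S condition)

endpointsˢ-++ : ∀ A B → endpointsˢ (A ++ˡ B) ≡ endpointsˢ A ++ˡ endpointsˢ B
endpointsˢ-++ []            B = refl
endpointsˢ-++ ((x , y) ∷ A) B = cong (λ l → x ∷ y ∷ l) (endpointsˢ-++ A B)

endpointsˢ-bounded : ∀ {L} A → All (IsAllocationˢ L) A → All (_< L.length L) (endpointsˢ A)
endpointsˢ-bounded         []            []                     = []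
endpointsˢ-bounded {L} ((x , y) ∷ A) ((_ , ex , ey) ∷ allocs) =
  lookupℕ-< L x ex ∷ lookupℕ-< L y ey ∷ endpointsˢ-bounded {L} A allocs

portListPool-++ : ∀ {k l} (Fs : Vec Formula k) (Gs : Vec Formula l) →
  portListPool (Fs ++ Gs) ≡ portListPool Fs ++ˡ portListPool Gs
portListPool-++ []       Gs = refl
portListPool-++ (F ∷ Fs) Gs =
  trans (cong (portListF F ++ˡ_) (portListPool-++ Fs Gs)) (sym (LP.++-assoc (portListF F) (portListPool Fs) (portListPool Gs)))

evalPoolˢ-++ : ∀ {k l} (Fs : Vec Formula k) (Gs : Vec Formula l) σ →
  evalPoolˢ (Fs ++ Gs) σ ≡ evalPoolˢ Fs σ ++ evalPoolˢ Gs (shift (nlitsPool Fs) σ)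
evalPoolˢ-++ []       Gs σ = refl
evalPoolˢ-++ (F ∷ Fs) Gs σ = cong (evalFˢ F σ ∷_) (trans (evalPoolˢ-++ Fs Gs (shift (nlits F) σ))
  (cong (evalPoolˢ Fs (shift (nlits F) σ) ++_) (evalPoolˢ-cong Gs (λ i → cong σ (sym (+-assoc (nlits F) (nlitsPool Fs) i))))))

evalGroup-++-outside : ∀ {k l} (Γ : Subset k) w (v : Vec Bool l) →
  evalGroup (Γ ++ replicate l outside) (w ++ v) ≡ evalGroup Γ w
evalGroup-++-outside []      []      v = none v
  where
  none : ∀ {l} (v : Vec Bool l) → evalGroup (replicate l outside) v ≡ false
  none []      = refl
  none (_ ∷ v) = none v
evalGroup-++-outside (g ∷ Γ) (x ∷ w) v = cong ((g ∧ᵇ x) ∨ᵇ_) (evalGroup-++-outside Γ w v)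

evalGroup-outside-++ : ∀ {k l} (Δ : Subset l) (w : Vec Bool k) v →
  evalGroup (replicate k outside ++ Δ) (w ++ v) ≡ evalGroup Δ v
evalGroup-outside-++ Δ []      v = refl
evalGroup-outside-++ Δ (_ ∷ w) v = evalGroup-outside-++ Δ w v

Trivialˢ-mix : ∀ {k l} {Γs : List (Subset k)} {Fs : Vec Formula k} {Δs : List (Subset l)} {Gs : Vec Formula l} →
  Trivialˢ (cq k Γs Fs) → Trivialˢ (cq l Δs Gs) →
  Trivialˢ (cq (k + l) (map (λ Γ → Γ ++ replicate l outside) Γs ++ˡ map (λ Δ → replicate k outside ++ Δ) Δs) (Fs ++ Gs))
Trivialˢ-mix {k} {l} {Γs} {Fs} {Δs} {Gs}
  (trivialˢ A₁ allocs₁ unique₁ trivializing₁) (trivialˢ A₂ allocs₂ unique₂ trivializing₂) =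
  trivialˢ A (subst (λ L → All (IsAllocationˢ L) A) (sym (portListPool-++ Fs Gs)) allocs) unique trivializing
  where
  n : ℕ
  n = nlitsPool Fs
  A : List (Pair ℕ)
  A = A₁ ++ˡ map (map-pair (n +_)) A₂
  allocs : All (IsAllocationˢ (portListPool Fs ++ˡ portListPool Gs)) A
  allocs = AllP.++⁺
    (All.map (λ { {x , y} (p , ex , ey) → p , lookupℕ-++ˡ (portListPool Fs) _ x ex , lookupℕ-++ˡ (portListPool Fs) _ y ey })
             allocs₁)
    (AllP.map⁺ (All.map (λ { {x , y} (p , ex , ey) → p , trans (shifted x) ex , trans (shifted y) ey }) allocs₂))
    where
    shifted : ∀ i → lookupℕ (portListPool Fs ++ˡ portListPool Gs) (n + i) ≡ lookupℕ (portListPool Gs) i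
    shifted i = subst (λ m → lookupℕ (portListPool Fs ++ˡ _) (m + i) ≡ _) (length-portListPool Fs)
                      (lookupℕ-++ʳ (portListPool Fs) _ i)
  separated : Disjoint (endpointsˢ A₁) (map (n +_) (endpointsˢ A₂))
  separated (v∈₁ , v∈₂) = <⇒≱ (All.lookup first v∈₁) (All.lookup second v∈₂)
    where
    first : All (_< n) (endpointsˢ A₁)
    first = subst (λ m → All (_< m) (endpointsˢ A₁)) (length-portListPool Fs)
                  (endpointsˢ-bounded {portListPool Fs} A₁ allocs₁)
    second : All (n ≤_) (map (n +_) (endpointsˢ A₂))
    second = AllP.map⁺ (All.universal (m≤m+n n) (endpointsˢ A₂))
  unique : Unique (endpointsˢ A)
  unique = subst Unique (sym (trans (endpointsˢ-++ A₁ _) (cong (endpointsˢ A₁ ++ˡ_) (endpointsˢ-map (n +_) A₂))))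
             (UniqueP.++⁺ unique₁ (UniqueP.map⁺ (+-cancelˡ-≡ n _ _) unique₂) separated)
  S : List (Subset (k + l))
  S = map (λ Γ → Γ ++ replicate l outside) Γs ++ˡ map (λ Δ → replicate k outside ++ Δ) Δs
  trivializing : ∀ σ → All (Respects σ) A → allGroups S (evalPoolˢ (Fs ++ Gs) σ) ≡ true
  trivializing σ respects = subst (λ w → allGroups S w ≡ true) (sym (evalPoolˢ-++ Fs Gs σ))
    (allGroups-true⁺ S _ (AllP.++⁺
      (AllP.map⁺ (All.map (λ {Γ} g → trans (evalGroup-++-outside Γ _ _) g) (allGroups-true⁻ Γs _ true₁)))
      (AllP.map⁺ (All.map (λ {Δ} g → trans (evalGroup-outside-++ Δ (evalPoolˢ Fs σ) _) g) (allGroups-true⁻ Δs _ true₂)))))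
    where
    true₁ : allGroups Γs (evalPoolˢ Fs σ) ≡ true
    true₁ = trivializing₁ σ (AllP.++⁻ˡ A₁ respects)
    true₂ : allGroups Δs (evalPoolˢ Gs (shift n σ)) ≡ true
    true₂ = trivializing₂ (shift n σ) (AllP.map⁻ {f = map-pair (n +_)} (AllP.++⁻ʳ A₁ respects))

Trivialˢ-axiom-atom : ∀ p → Trivialˢ (cq 2 ((inside ∷ inside ∷ []) ∷ []) (natom p ∷ atom p ∷ []))
Trivialˢ-axiom-atom p = trivialˢ ((0 , 1) ∷ []) ((p , refl , refl) ∷ []) (((λ ()) ∷ []) ∷ [] ∷ []) trivializing
  where
  trivializing : ∀ σ → All (Respects σ) ((0 , 1) ∷ []) →
                 truthˢ (cq 2 ((inside ∷ inside ∷ []) ∷ []) (natom p ∷ atom p ∷ [])) σ ≡ true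
  trivializing σ (r ∷ []) with σ 0
  ... | false = refl
  ... | true rewrite r refl = refl

Trivialˢ-axiom-natom : ∀ p → Trivialˢ (cq 2 ((inside ∷ inside ∷ []) ∷ []) (atom p ∷ natom p ∷ []))
Trivialˢ-axiom-natom p = trivialˢ ((1 , 0) ∷ []) ((p , refl , refl) ∷ []) (((λ ()) ∷ []) ∷ [] ∷ []) trivializing
  where
  trivializing : ∀ σ → All (Respects σ) ((1 , 0) ∷ []) →
                 truthˢ (cq 2 ((inside ∷ inside ∷ []) ∷ []) (atom p ∷ natom p ∷ [])) σ ≡ true
  trivializing σ (r ∷ []) with σ 1 | σ 0
  ... | false | false = refl
  ... | false | true  = refl
  ... | true  | true  = refl
  ... | true  | false = ⊥-elim (false≢true (r refl))

Trivialˢ-axiom : ∀ F → Trivialˢ (cq 2 ((inside ∷ inside ∷ []) ∷ []) (neg F ∷ F ∷ []))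
Trivialˢ-axiom (atom p)  = Trivialˢ-axiom-atom p
Trivialˢ-axiom (natom p) = Trivialˢ-axiom-natom p
Trivialˢ-axiom (F ∧ G)   = Trivialˢ-and 1 (AndPaired⇒AndCondition 1 (pair refl refl refl refl []))
  (Trivialˢ-or 0 (Trivialˢ-exch 1 (Trivialˢ-mix (Trivialˢ-axiom F) (Trivialˢ-axiom G))))
Trivialˢ-axiom (F ∨ G)   = Trivialˢ-or 1
  (Trivialˢ-and 0 (AndPaired⇒AndCondition 0 (pair refl refl refl refl []))
    (Trivialˢ-exch 1 (Trivialˢ-mix (Trivialˢ-axiom F) (Trivialˢ-axiom G))))

soundnessˢ : ∀ {C} → Provable C → Trivialˢ C
soundnessˢ ax-empty                   = trivialˢ [] [] [] λ _ _ → refl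
soundnessˢ (ax-id F)                  = Trivialˢ-axiom F
soundnessˢ (mix p q)                  = Trivialˢ-mix (soundnessˢ p) (soundnessˢ q)
soundnessˢ (exch-formula a p)         = Trivialˢ-exch a (soundnessˢ p)
soundnessˢ (exch-group xs Γ Δ ys p)   = Trivialˢ-exch-group xs Γ Δ ys (soundnessˢ p)
soundnessˢ (weak-group xs Γ ys i p)   = Trivialˢ-weak-group xs Γ ys i (soundnessˢ p)
soundnessˢ (weak-formula i F p)       = Trivialˢ-weak-formula i F (soundnessˢ p)
soundnessˢ (dup xs Γ ys p)            = Trivialˢ-dup xs Γ ys (soundnessˢ p)
soundnessˢ (undup xs Γ ys p)          = Trivialˢ-undup xs Γ ys (soundnessˢ p)
soundnessˢ (or-rule a p)              = Trivialˢ-or a (soundnessˢ p)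
soundnessˢ (and-rule a condition p)   = Trivialˢ-and a condition (soundnessˢ p)

soundness : ∀ {C} → Provable C → Trivial C
soundness {C} p = Trivialˢ⇒Trivial C (soundnessˢ p)

dup-replicate : ∀ {k} n (G : Subset k) R {P} → Provable (cq k (G ∷ R) P) → Provable (cq k (L.replicate (suc n) G ++ˡ R) P)
dup-replicate zero    G R p = p
dup-replicate (suc n) G R p = dup [] G (L.replicate n G ++ˡ R) (dup-replicate n G R p)

there⁻ : ∀ {X : Set} {n} {x y : X} {i : Fin n} {xs : Vec X n} → (y ∷ xs) [ Fin.suc i ]= x → xs [ i ]= x
there⁻ (there p) = p

insertAll : ∀ {k} → List (Fin k) → Subset k → Subset k
insertAll []       G = G
insertAll (i ∷ is) G = insertAll is (G [ i ]≔ inside)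

insertAll-suc : ∀ {k} (is : List (Fin k)) g (G : Subset k) → insertAll (map Fin.suc is) (g ∷ G) ≡ g ∷ insertAll is G
insertAll-suc []       g G = refl
insertAll-suc (i ∷ is) g G = insertAll-suc is g (G [ i ]≔ inside)

⊆⇒insertAll : ∀ {k} (G Γ : Subset k) → G ⊆ Γ → Σ (List (Fin k)) λ is → insertAll is G ≡ Γ
⊆⇒insertAll []      []      _   = [] , refl
⊆⇒insertAll (g ∷ G) (c ∷ Γ) G⊆Γ with ⊆⇒insertAll G Γ (λ x∈G → there⁻ (G⊆Γ (there x∈G)))
⊆⇒insertAll (g     ∷ G) (true  ∷ Γ) G⊆Γ | is , refl = Fin.zero ∷ map Fin.suc is , insertAll-suc is true G
⊆⇒insertAll (false ∷ G) (false ∷ Γ) G⊆Γ | is , refl = map Fin.suc is , insertAll-suc is false G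
⊆⇒insertAll (true  ∷ G) (false ∷ Γ) G⊆Γ | _ with G⊆Γ here
... | ()

weaken-⊆ : ∀ {k} xs (G Γ : Subset k) ys {P} → G ⊆ Γ →
  Provable (cq k (xs ++ˡ (G ∷ ys)) P) → Provable (cq k (xs ++ˡ (Γ ∷ ys)) P)
weaken-⊆ xs G Γ ys G⊆Γ p with ⊆⇒insertAll G Γ G⊆Γ
... | is , refl = weaken-all is G p
  where
  weaken-all : ∀ is G → Provable (cq _ (xs ++ˡ (G ∷ ys)) _) → Provable (cq _ (xs ++ˡ (insertAll is G ∷ ys)) _)
  weaken-all []       G p = p
  weaken-all (i ∷ is) G p = weaken-all is (G [ i ]≔ inside) (weak-group xs G ys i p)

regroup-snoc : ∀ {k} xs (Γ : Subset k) S {P} →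
  Provable (cq k (xs ++ˡ (Γ ∷ S)) P) → Provable (cq k ((xs ∷ʳ Γ) ++ˡ S) P)
regroup-snoc xs Γ S = subst (λ S′ → Provable (cq _ S′ _)) (sym (LP.++-assoc xs (Γ ∷ []) S))

regroup-unsnoc : ∀ {k} xs (Γ : Subset k) S {P} →
  Provable (cq k ((xs ∷ʳ Γ) ++ˡ S) P) → Provable (cq k (xs ++ˡ (Γ ∷ S)) P)
regroup-unsnoc xs Γ S = subst (λ S′ → Provable (cq _ S′ _)) (LP.++-assoc xs (Γ ∷ []) S)

weaken-pointwise : ∀ {k} xs {S₁ S₂ : List (Subset k)} {P} → Pointwise _⊆_ S₁ S₂ →
  Provable (cq k (xs ++ˡ S₁) P) → Provable (cq k (xs ++ˡ S₂) P)
weaken-pointwise xs []                                   p = p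
weaken-pointwise xs (_∷_ {G} {Γ} {S₁} {S₂} G⊆Γ S₁⊆S₂) p =
  regroup-unsnoc xs Γ S₂ (weaken-pointwise (xs ∷ʳ Γ) S₁⊆S₂ (regroup-snoc xs Γ S₁ (weaken-⊆ xs G Γ S₁ G⊆Γ p)))

permute : ∀ {k} xs {S₁ S₂ : List (Subset k)} {P} → S₁ ↭ S₂ →
  Provable (cq k (xs ++ˡ S₁) P) → Provable (cq k (xs ++ˡ S₂) P)
permute xs Perm.refl              p = p
permute xs (Perm.prep {S₁} {S₂} Γ σ) p =
  regroup-unsnoc xs Γ S₂ (permute (xs ∷ʳ Γ) σ (regroup-snoc xs Γ S₁ p))
permute xs (Perm.swap {S₁} {S₂} Γ Δ σ) p =
  regroup-unsnoc xs Δ (Γ ∷ S₂) (regroup-unsnoc (xs ∷ʳ Δ) Γ S₂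
    (permute ((xs ∷ʳ Δ) ∷ʳ Γ) σ
      (regroup-snoc (xs ∷ʳ Δ) Γ S₁ (regroup-snoc xs Δ (Γ ∷ S₁) (exch-group xs Γ Δ S₁ p)))))
permute xs (Perm.trans σ τ)       p = permute xs τ (permute xs σ p)

spread : ∀ {k} (G : Subset k) T R {P} → 0 < L.length T → All (G ⊆_) T →
  Provable (cq k (G ∷ R) P) → Provable (cq k (T ++ˡ R) P)
spread G (Γ ∷ T) R _ G⊆T p =
  weaken-pointwise [] (Pointwise.++⁺ (replicate-⊆ (Γ ∷ T) G⊆T) (Pointwise.refl (λ {Γ} {x} x∈ → x∈)))
    (dup-replicate (L.length T) G R p)
  where
  replicate-⊆ : ∀ T → All (G ⊆_) T → Pointwise _⊆_ (L.replicate (L.length T) G) T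
  replicate-⊆ []      []          = []
  replicate-⊆ (_ ∷ T) (G⊆Γ ∷ G⊆T) = G⊆Γ ∷ replicate-⊆ T G⊆T

neg-involutive : ∀ F → neg (neg F) ≡ F
neg-involutive (atom p)  = refl
neg-involutive (natom p) = refl
neg-involutive (F ∧ G)   = cong₂ _∧_ (neg-involutive F) (neg-involutive G)
neg-involutive (F ∨ G)   = cong₂ _∨_ (neg-involutive F) (neg-involutive G)

neg-≢ : ∀ F → neg F ≢ F
neg-≢ (atom p)  ()
neg-≢ (natom p) ()
neg-≢ (F ∧ G)   ()
neg-≢ (F ∨ G)   ()

Apart : ∀ {X : Set} → Pair X → Pair X → Set
Apart (x₁ , y₁) (x₂ , y₂) = x₁ ≢ x₂ × x₁ ≢ y₂ × y₁ ≢ x₂ × y₁ ≢ y₂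

record Matching (X : Set) : Set₁ where
  field
    Chosen : Pair X → Set
    apart  : ∀ {u v} → Chosen u → Chosen v → u ≡ v ⊎ Apart u v
open Matching

Linked : ∀ {k} → Vec Formula k → Subset k → Pair (Fin k) → Set
Linked P Γ (x , y) = x ∈ Γ × y ∈ Γ × neg (V.lookup P x) ≡ V.lookup P y

LinkedBy : ∀ {k} → Matching (Fin k) → Vec Formula k → Subset k → Set
LinkedBy {k} M P Γ = Σ (Pair (Fin k)) λ u → Chosen M u × Linked P Γ u

Matched : ∀ {k} → List (Subset k) → Vec Formula k → Set₁
Matched {k} S P = Σ (Matching (Fin k)) λ M → All (LinkedBy M P) S

restrict : ∀ {X Y : Set} (ρ : X → Y) → (∀ {x y} → ρ x ≡ ρ y → x ≡ y) → Matching Y → Matching X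
restrict ρ ρ-injective M = record { Chosen = Chosen M ∘ map-pair ρ ; apart = apart′ }
  where
  apart′ : ∀ {u v} → Chosen M (map-pair ρ u) → Chosen M (map-pair ρ v) → u ≡ v ⊎ Apart u v
  apart′ {x₁ , y₁} {x₂ , y₂} cu cv with apart M cu cv
  ... | inj₁ e = inj₁ (cong₂ _,_ (ρ-injective (cong proj₁ e)) (ρ-injective (cong proj₂ e)))
  ... | inj₂ (d₁ , d₂ , d₃ , d₄) = inj₂ (d₁ ∘ cong ρ , d₂ ∘ cong ρ , d₃ ∘ cong ρ , d₄ ∘ cong ρ)

Links : ∀ {m} → Fin m → Subset (suc m) → Set
Links j Γ = Fin.zero ∈ Γ × Fin.suc j ∈ Γ

links? : ∀ {m} (j : Fin m) → Decidable (Links j)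
links? j Γ = (Fin.zero ∈? Γ) ×-dec (Fin.suc j ∈? Γ)

LinkedAvoidingZero : ∀ {m} → Matching (Fin (suc m)) → Formula → Vec Formula m → Subset (suc m) → Set
LinkedAvoidingZero {m} M ℓ P Γ = Σ (Pair (Fin m)) λ u → Chosen M (map-pair Fin.suc u) × Linked (ℓ ∷ P) Γ (map-pair Fin.suc u)

Touching : ∀ {m} → Fin m → Pair (Fin (suc m)) → Set
Touching j u = u ≡ (Fin.zero , Fin.suc j) ⊎ u ≡ (Fin.suc j , Fin.zero)

data ZeroView {m} (M : Matching (Fin (suc m))) (ℓ : Formula) (P : Vec Formula m) (S : List (Subset (suc m))) : Set where
  avoids  : All (LinkedAvoidingZero M ℓ P) S → ZeroView M ℓ P S
  touches : ∀ j {u} → Chosen M u → Touching j u → neg (V.lookup P j) ≡ ℓ → Any (Links j) S → ZeroView M ℓ P S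

zeroView : ∀ {m} (M : Matching (Fin (suc m))) ℓ (P : Vec Formula m) (S : List (Subset (suc m))) →
  All (LinkedBy M (ℓ ∷ P)) S → ZeroView M ℓ P S
zeroView M ℓ P [] [] = avoids []
zeroView M ℓ P (Γ ∷ S) (((Fin.zero , Fin.zero) , _ , _ , _ , n) ∷ _) = ⊥-elim (neg-≢ ℓ n)
zeroView M ℓ P (Γ ∷ S) (((Fin.zero , Fin.suc j) , c , x∈ , y∈ , n) ∷ _) =
  touches j c (inj₁ refl) (trans (cong neg (sym n)) (neg-involutive ℓ)) (here (x∈ , y∈))
zeroView M ℓ P (Γ ∷ S) (((Fin.suc j , Fin.zero) , c , x∈ , y∈ , n) ∷ _) =
  touches j c (inj₂ refl) n (here (y∈ , x∈))
zeroView M ℓ P (Γ ∷ S) (((Fin.suc x , Fin.suc y) , c , l) ∷ ls) with zeroView M ℓ P S ls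
... | avoids as              = avoids (((x , y) , c , l) ∷ as)
... | touches j cu tu n any  = touches j cu tu n (there any)

matched-avoiding : ∀ {k} (S : List (Subset (suc k))) ℓ (P : Vec Formula k) (M : Matching (Fin (suc k))) →
  All (LinkedAvoidingZero M ℓ P) S → (Matched (map V.tail S) P → Provable (cq k (map V.tail S) P)) → Provable (cq (suc k) S (ℓ ∷ P))
matched-avoiding S ℓ P M avoiding provable =
  weaken-pointwise [] (tail-⊆ S) (weak-formula Fin.zero ℓ (provable (restrict Fin.suc FinP.suc-injective M , linked)))
  where
  linked : All (LinkedBy (restrict Fin.suc FinP.suc-injective M) P) (map V.tail S)
  linked = AllP.map⁺ (All.map (λ { {_ ∷ _} (u , c , x∈ , y∈ , n) → u , c , there⁻ x∈ , there⁻ y∈ , n }) avoiding)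
  tail-⊆ : ∀ S → Pointwise _⊆_ (map (outside ∷_) (map V.tail S)) S
  tail-⊆ []            = []
  tail-⊆ ((_ ∷ _) ∷ S) = (λ { (there x∈) → there x∈ }) ∷ tail-⊆ S

apart-touching : ∀ {m} (j : Fin (suc m)) {u w} → Touching j u → Apart w u →
  Σ (Fin (suc m)) λ x → Σ (Fin (suc m)) λ y → w ≡ (Fin.suc x , Fin.suc y) × j ≢ x × j ≢ y
apart-touching j {w = Fin.zero  , _        } (inj₁ refl) (d₁ , _)           = ⊥-elim (d₁ refl)
apart-touching j {w = Fin.suc _ , Fin.zero } (inj₁ refl) (_ , _ , d₃ , _)   = ⊥-elim (d₃ refl)
apart-touching j {w = Fin.suc x , Fin.suc y} (inj₁ refl) (_ , d₂ , _ , d₄)  =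
  x , y , refl , d₂ ∘ cong Fin.suc ∘ sym , d₄ ∘ cong Fin.suc ∘ sym
apart-touching j {w = Fin.zero  , _        } (inj₂ refl) (_ , d₂ , _)       = ⊥-elim (d₂ refl)
apart-touching j {w = Fin.suc _ , Fin.zero } (inj₂ refl) (_ , _ , _ , d₄)   = ⊥-elim (d₄ refl)
apart-touching j {w = Fin.suc x , Fin.suc y} (inj₂ refl) (d₁ , _ , d₃ , _)  =
  x , y , refl , d₁ ∘ cong Fin.suc ∘ sym , d₃ ∘ cong Fin.suc ∘ sym

touching-links : ∀ {m} (j : Fin (suc m)) {u} (Γ : Subset (suc (suc m))) → Touching j u →
  proj₁ u ∈ Γ → proj₂ u ∈ Γ → Links j Γ
touching-links j Γ (inj₁ refl) x∈ y∈ = x∈ , y∈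
touching-links j Γ (inj₂ refl) x∈ y∈ = y∈ , x∈

∈-removeAt : ∀ {m} (γ : Subset (suc m)) {j x} (j≢x : j ≢ x) → x ∈ γ → Fin.punchOut j≢x ∈ V.removeAt γ j
∈-removeAt γ j≢x x∈ = lookup⇒[]= _ _ (trans (VP.removeAt-punchOut γ j≢x) ([]=⇒lookup x∈))
  where open VP using (lookup⇒[]=; []=⇒lookup)

skipping : ∀ {m} → Fin (suc m) → Fin m → Fin (suc (suc m))
skipping j = Fin.suc ∘ Fin.punchIn j

skipping-injective : ∀ {m} (j : Fin (suc m)) {x y} → skipping j x ≡ skipping j y → x ≡ y
skipping-injective j e = FinP.punchIn-injective j _ _ (FinP.suc-injective e)

linked-removeAt : ∀ {m} (M : Matching (Fin (suc (suc m)))) ℓ (P : Vec Formula (suc m)) j {u} → Chosen M u → Touching j u →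
  ∀ Γ → ¬ Links j Γ → LinkedBy M (ℓ ∷ P) Γ →
  LinkedBy (restrict (skipping j) (skipping-injective j) M) (V.removeAt P j) (V.removeAt (V.tail Γ) j)
linked-removeAt M ℓ P j cu tu (g ∷ γ) ¬links (w , cw , x∈ , y∈ , n) with apart M cw cu
... | inj₁ refl = ⊥-elim (¬links (touching-links j (g ∷ γ) tu x∈ y∈))
... | inj₂ w#u with apart-touching j tu w#u
...   | x , y , refl , j≢x , j≢y =
  (Fin.punchOut j≢x , Fin.punchOut j≢y) ,
  subst (Chosen M) (sym (cong₂ (λ a b → (Fin.suc a , Fin.suc b))
                              (FinP.punchIn-punchOut j≢x) (FinP.punchIn-punchOut j≢y))) cw ,
  ∈-removeAt γ j≢x (there⁻ x∈) , ∈-removeAt γ j≢y (there⁻ y∈) ,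
  trans (cong neg (VP.removeAt-punchOut P j≢x)) (trans n (sym (VP.removeAt-punchOut P j≢y)))

filter-partition-↭ : ∀ {X : Set} {Q : X → Set} (Q? : Decidable Q) xs → xs ↭ filter Q? xs ++ˡ filter (∁? Q?) xs
filter-partition-↭ Q? xs = subst (λ (ys , zs) → xs ↭ ys ++ˡ zs) (LP.partition-defn Q? xs)
  (Perm.↭ₛ⇒↭ (PermSetoidP.partition-↭ (≡-setoid _) Q? xs))

∈-insertAt-outside : ∀ {m} (j : Fin (suc m)) {i} → i ∈ insertAt (replicate m outside) j inside → i ≡ j
∈-insertAt-outside               Fin.zero    here       = refl
∈-insertAt-outside               Fin.zero    {Fin.suc i} (there i∈) =
  ⊥-elim (false≢true (trans (sym (VP.lookup-replicate i outside)) (VP.[]=⇒lookup i∈)))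
∈-insertAt-outside {suc m}       (Fin.suc j) (there i∈) = cong Fin.suc (∈-insertAt-outside j i∈)

insertAt-outside-⊆ : ∀ {m} (v : Subset m) j c → insertAt v j outside ⊆ insertAt v j c
insertAt-outside-⊆ v       Fin.zero    c (there i∈) = there i∈
insertAt-outside-⊆ (_ ∷ v) (Fin.suc j) c here       = here
insertAt-outside-⊆ (_ ∷ v) (Fin.suc j) c (there i∈) = there (insertAt-outside-⊆ v j c i∈)

-- A pair {0, suc j} shared by the groups T is discharged by one axiom
-- ¬ z , z whose group is duplicated and weakened to each group of T; the
-- other groups O keep their own pairs once positions 0 and suc j are removed.
matched-touching : ∀ {m} (S : List (Subset (suc (suc m)))) ℓ (P : Vec Formula (suc m)) (M : Matching (Fin (suc (suc m)))) j {u} →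
  Chosen M u → Touching j u → neg (V.lookup P j) ≡ ℓ → Any (Links j) S → All (LinkedBy M (ℓ ∷ P)) S →
  (∀ {S′ P′} → Matched S′ P′ → Provable (cq m S′ P′)) → Provable (cq (suc (suc m)) S (ℓ ∷ P))
matched-touching {m} S ℓ P M j cu tu n any linked provable =
  permute [] (Perm.↭-sym (filter-partition-↭ (links? j) S))
    (spread cover T O (LP.filter-some (links? j) any) (All.map cover-⊆ (AllP.all-filter (links? j) S))
      (weaken-pointwise (cover ∷ []) (restore-⊆ O) axiom-and-rest))
  where
  T O : List (Subset (suc (suc m)))
  T = filter (links? j) S
  O = filter (∁? (links? j)) S
  cover : Subset (suc (suc m))
  cover = inside ∷ insertAt (replicate m outside) j inside
  remove : Subset (suc (suc m)) → Subset m
  remove Γ = V.removeAt (V.tail Γ) j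
  restore : Subset (suc (suc m)) → Subset (suc (suc m))
  restore Γ = outside ∷ insertAt (remove Γ) j outside
  cover-⊆ : ∀ {Γ} → Links j Γ → cover ⊆ Γ
  cover-⊆ (0∈ , _)  here       = 0∈
  cover-⊆ (_ , j∈) (there i∈) rewrite ∈-insertAt-outside j i∈ = j∈
  restore-⊆ : ∀ O → Pointwise _⊆_ (map restore O) O
  restore-⊆ []            = []
  restore-⊆ ((g ∷ γ) ∷ O) =
    (λ { (there i∈) → there (subst (_ ∈_) (VP.insertAt-removeAt γ j) (insertAt-outside-⊆ (V.removeAt γ j) j _ i∈)) })
    ∷ restore-⊆ O
  rest : Provable (cq m (map remove O) (V.removeAt P j))
  rest = provable (restrict (skipping j) (skipping-injective j) M ,
    AllP.map⁺ (All.zipWith (λ { {Γ} (¬links , l) → linked-removeAt M ℓ P j cu tu Γ ¬links l })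
                           (AllP.all-filter (∁? (links? j)) S , AllP.filter⁺ (∁? (links? j)) linked)))
  axiom-and-rest : Provable (cq (suc (suc m)) (cover ∷ map restore O) (ℓ ∷ P))
  axiom-and-rest = subst₂ (λ S′ P′ → Provable (cq _ S′ P′))
    (cong₂ _∷_ (sink₁-insertAt inside inside (replicate m outside) j)
      (trans (sym (LP.map-∘ {g = sink 1 (toℕ j)} {f = λ v → outside ∷ outside ∷ v} (map remove O)))
        (trans (LP.map-cong (λ v → sink₁-insertAt outside outside v j) (map remove O))
          (sym (LP.map-∘ {g = λ v → outside ∷ insertAt v j outside} {f = remove} O)))))
    (trans (sink₁-insertAt _ _ (V.removeAt P j) j) (cong₂ _∷_ n (VP.insertAt-removeAt P j)))
    (sink-closed {Q = Provable} exch-formula 1 (toℕ j) (mix (ax-id (V.lookup P j)) rest))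

matched⇒provable : ∀ k (S : List (Subset k)) P → Matched S P → Provable (cq k S P)
matched⇒provable zero    []      []      _                            = ax-empty
matched⇒provable zero    (Γ ∷ S) []      (M , ((() , _) , _) ∷ _)
matched⇒provable (suc k) S       (ℓ ∷ P) (M , linked) with zeroView M ℓ P S linked
... | avoids avoiding = matched-avoiding S ℓ P M avoiding (matched⇒provable k (map V.tail S) P)
matched⇒provable (suc zero)    S (ℓ ∷ P) (M , linked) | touches () _ _ _ _
matched⇒provable (suc (suc m)) S (ℓ ∷ P) (M , linked) | touches j cu tu n any =
  matched-touching S ℓ P M j cu tu n any linked (matched⇒provable m _ _)

∈-endpointsˢ : ∀ {A x y} → (x , y) ∈ˡ A → x ∈ˡ endpointsˢ A × y ∈ˡ endpointsˢ A
∈-endpointsˢ {(_ , _) ∷ A} (here refl) = here refl , there (here refl)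
∈-endpointsˢ {(_ , _) ∷ A} (there xy∈) with ∈-endpointsˢ xy∈
... | x∈ , y∈ = there (there x∈) , there (there y∈)

monogamous-apart : ∀ A → Unique (endpointsˢ A) → ∀ {u v} → u ∈ˡ A → v ∈ˡ A → u ≡ v ⊎ Apart u v
monogamous-apart ((x , y) ∷ A) _                     (here refl) (here refl) = inj₁ refl
monogamous-apart ((x , y) ∷ A) ((_ ∷ x#) ∷ y# ∷ _)  (here refl) (there v∈) with ∈-endpointsˢ v∈
... | x′∈ , y′∈ = inj₂ (All.lookup x# x′∈ , All.lookup x# y′∈ , All.lookup y# x′∈ , All.lookup y# y′∈)
monogamous-apart ((x , y) ∷ A) ((_ ∷ x#) ∷ y# ∷ _)  (there u∈) (here refl) with ∈-endpointsˢ u∈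
... | x′∈ , y′∈ =
  inj₂ (All.lookup x# x′∈ ∘ sym , All.lookup y# x′∈ ∘ sym , All.lookup x# y′∈ ∘ sym , All.lookup y# y′∈ ∘ sym)
monogamous-apart ((x , y) ∷ A) (_ ∷ _ ∷ unique)     (there u∈) (there v∈) = monogamous-apart A unique u∈ v∈

arrangementMatching : ∀ {k} A → Unique (endpointsˢ A) → Matching (Fin k)
arrangementMatching A unique = restrict toℕ FinP.toℕ-injective (record { Chosen = _∈ˡ A ; apart = monogamous-apart A unique })

data IsLiteral : Formula → Set where
  atom  : ∀ p → IsLiteral (atom p)
  natom : ∀ p → IsLiteral (natom p)

literalOf : Port → Formula
literalOf (out p) = atom p
literalOf (inp p) = natom p

literal-port : ∀ {k} {P : Vec Formula k} → VAll IsLiteral P → ∀ x {v} → lookupℕ (portListPool P) x ≡ just v →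
  Σ (Fin k) λ i → toℕ i ≡ x × V.lookup P i ≡ literalOf v
literal-port (atom p  VAll.∷ _)  zero    refl = Fin.zero , refl , refl
literal-port (natom p VAll.∷ _)  zero    refl = Fin.zero , refl , refl
literal-port (atom p  VAll.∷ ls) (suc x) e with literal-port ls x e
... | i , refl , Pᵢ = Fin.suc i , refl , Pᵢ
literal-port (natom p VAll.∷ ls) (suc x) e with literal-port ls x e
... | i , refl , Pᵢ = Fin.suc i , refl , Pᵢ

-- Every literal of Γ is made false and every other literal true, so an
-- allocation can only be violated between two literals of Γ.
refuting : Formula → Bool → Bool
refuting (atom _) g = not g
refuting _        g = g

refutation : ∀ {k} → Vec Formula k → Subset k → ℕ → Bool
refutation P Γ = stream (V.zipWith refuting P Γ)

refutation-toℕ : ∀ {k} (P : Vec Formula k) Γ i → refutation P Γ (toℕ i) ≡ refuting (V.lookup P i) (V.lookup Γ i)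
refutation-toℕ P Γ i = trans (stream-toℕ (V.zipWith refuting P Γ) i) (VP.lookup-zipWith refuting i P Γ)

refutation-refutes : ∀ {k} {P : Vec Formula k} → VAll IsLiteral P → (Γ : Subset k) →
  evalGroup Γ (evalPoolˢ P (refutation P Γ)) ≡ false
refutation-refutes VAll.[]              []          = refl
refutation-refutes (atom p  VAll.∷ ls)  (true  ∷ Γ) = refutation-refutes ls Γ
refutation-refutes (atom p  VAll.∷ ls)  (false ∷ Γ) = refutation-refutes ls Γ
refutation-refutes (natom p VAll.∷ ls)  (true  ∷ Γ) = refutation-refutes ls Γ
refutation-refutes (natom p VAll.∷ ls)  (false ∷ Γ) = refutation-refutes ls Γ

violated : ∀ σ A → ¬ All (Respects σ) A → Σ (Pair ℕ) λ (x , y) → (x , y) ∈ˡ A × σ x ≡ true × σ y ≡ false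
violated σ A ¬respects with find (AllP.¬All⇒Any¬ (λ (x , y) → (σ x ≟ᵇ true) →-dec (σ y ≟ᵇ true)) A ¬respects)
... | (x , y) , xy∈ , ¬r with σ x in σx | σ y in σy
...   | true  | false = (x , y) , xy∈ , σx , σy
...   | true  | true  = ⊥-elim (¬r (λ _ → refl))
...   | false | _     = ⊥-elim (¬r (λ ()))

refutation-violated : ∀ {k} {P : Vec Formula k} → VAll IsLiteral P → (Γ : Subset k) (A : List (Pair ℕ)) →
  All (IsAllocationˢ (portListPool P)) A → ¬ All (Respects (refutation P Γ)) A →
  Σ (Pair (Fin k)) λ u → map-pair toℕ u ∈ˡ A × Linked P Γ u
refutation-violated {P = P} literals Γ A allocs ¬respects with violated (refutation P Γ) A ¬respects
... | (x , y) , xy∈ , σx , σy with All.lookup allocs xy∈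
...   | p , ex , ey with literal-port literals x ex | literal-port literals y ey
...     | i , refl , Pᵢ | j , refl , Pⱼ =
  (i , j) , xy∈ ,
  VP.lookup⇒[]= i Γ (trans (sym (refuting-at i Pᵢ)) σx) ,
  VP.lookup⇒[]= j Γ (not-injective (trans (sym (refuting-at j Pⱼ)) σy)) ,
  trans (cong neg Pᵢ) (sym Pⱼ)
  where
  refuting-at : ∀ i {F} → V.lookup P i ≡ F → refutation P Γ (toℕ i) ≡ refuting F (V.lookup Γ i)
  refuting-at i refl = refutation-toℕ P Γ i

trivial-literals⇒matched : ∀ {k} (S : List (Subset k)) (P : Vec Formula k) → VAll IsLiteral P →
  Trivialˢ (cq k S P) → Matched S P
trivial-literals⇒matched S P literals (trivialˢ A allocs unique trivializing) =
  arrangementMatching A unique , All.tabulate λ {Γ} Γ∈S → refutation-violated literals Γ A allocs λ respects →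
    false≢true (trans (sym (refutation-refutes literals Γ)) (All.lookup (allGroups-true⁻ S _ (trivializing _ respects)) Γ∈S))

unmerge : ∀ a {b} → (Bool → Bool) → (Bool → Bool) → Subset (a + suc b) → Subset (a + suc (suc b))
unmerge zero    h₁ h₂ (g ∷ Γ) = h₁ g ∷ h₂ g ∷ Γ
unmerge (suc a) h₁ h₂ (g ∷ Γ) = g ∷ unmerge a h₁ h₂ Γ

entryAt : ∀ {X : Set} a {b} → Vec X (a + suc b) → X
entryAt zero    (x ∷ _) = x
entryAt (suc a) (_ ∷ v) = entryAt a v

fstOf-unmerge : ∀ a {b} h₁ h₂ (Γ : Subset (a + suc b)) → fstOf a (unmerge a h₁ h₂ Γ) ≡ h₁ (entryAt a Γ)
fstOf-unmerge zero    h₁ h₂ (g ∷ Γ) = refl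
fstOf-unmerge (suc a) h₁ h₂ (g ∷ Γ) = fstOf-unmerge a h₁ h₂ Γ

sndOf-unmerge : ∀ a {b} h₁ h₂ (Γ : Subset (a + suc b)) → sndOf a (unmerge a h₁ h₂ Γ) ≡ h₂ (entryAt a Γ)
sndOf-unmerge zero    h₁ h₂ (g ∷ Γ) = refl
sndOf-unmerge (suc a) h₁ h₂ (g ∷ Γ) = sndOf-unmerge a h₁ h₂ Γ

mergeWith-unmerge : ∀ a {b} h₁ h₂ (Γ : Subset (a + suc b)) → (∀ g → h₁ g ∨ᵇ h₂ g ≡ g) →
  mergeWith a _∨ᵇ_ (unmerge a h₁ h₂ Γ) ≡ Γ
mergeWith-unmerge zero    h₁ h₂ (g ∷ Γ) h = cong (_∷ Γ) (h g)
mergeWith-unmerge (suc a) h₁ h₂ (g ∷ Γ) h = cong (g ∷_) (mergeWith-unmerge a h₁ h₂ Γ h)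

unmerge-∪ : ∀ a {b} h₁ h₂ h₁′ h₂′ (Γ : Subset (a + suc b)) →
  unmerge a h₁ h₂ Γ ∪ unmerge a h₁′ h₂′ Γ ≡
  unmerge a (λ g → h₁ g ∨ᵇ h₁′ g) (λ g → h₂ g ∨ᵇ h₂′ g) Γ
unmerge-∪ zero    h₁ h₂ h₁′ h₂′ (g ∷ Γ) = cong (λ Δ → _ ∷ _ ∷ Δ) (∪-idem Γ)
unmerge-∪ (suc a) h₁ h₂ h₁′ h₂′ (g ∷ Γ) = cong₂ _∷_ (∨ᵇ-idem g) (unmerge-∪ a h₁ h₂ h₁′ h₂′ Γ)

evalGroupExcept-unmerge : ∀ a {b} h₁ h₂ (Γ : Subset (a + suc b)) w →
  evalGroupExcept a (unmerge a h₁ h₂ Γ) w ≡ evalGroupExcept a (unmerge a id id Γ) w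
evalGroupExcept-unmerge zero    h₁ h₂ (g ∷ Γ) (_ ∷ _ ∷ w) = refl
evalGroupExcept-unmerge (suc a) h₁ h₂ (g ∷ Γ) (x ∷ w)     =
  cong ((g ∧ᵇ x) ∨ᵇ_) (evalGroupExcept-unmerge a h₁ h₂ Γ w)

evalGroup-unmerge : ∀ a {b} h₁ h₂ (Γ : Subset (a + suc b)) w {g} → entryAt a Γ ≡ g →
  evalGroup (unmerge a h₁ h₂ Γ) w ≡
  (h₁ g ∧ᵇ fstOf a w) ∨ᵇ ((h₂ g ∧ᵇ sndOf a w) ∨ᵇ evalGroupExcept a (unmerge a id id Γ) w)
evalGroup-unmerge a h₁ h₂ Γ w refl =
  trans (evalGroup-adjacent a (unmerge a h₁ h₂ Γ) w (fstOf-unmerge a h₁ h₂ Γ) (sndOf-unmerge a h₁ h₂ Γ))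
        (cong (λ r → (h₁ (entryAt a Γ) ∧ᵇ fstOf a w) ∨ᵇ ((h₂ (entryAt a Γ) ∧ᵇ sndOf a w) ∨ᵇ r))
              (evalGroupExcept-unmerge a h₁ h₂ Γ w))

evalGroup-mergeWith-situation : ∀ a {b} h (Γ : Subset (a + suc b)) w {g} → entryAt a Γ ≡ g →
  evalGroup Γ (mergeWith a h w) ≡ (g ∧ᵇ h (fstOf a w) (sndOf a w)) ∨ᵇ evalGroupExcept a (unmerge a id id Γ) w
evalGroup-mergeWith-situation a h Γ w {g} refl = begin
  evalGroup Γ (mergeWith a h w)
    ≡⟨ cong (λ Δ → evalGroup Δ (mergeWith a h w)) (sym Γ-merged) ⟩
  evalGroup (mergeWith a _∨ᵇ_ (unmerge a id id Γ)) (mergeWith a h w)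
    ≡⟨ evalGroup-mergeWith a _∨ᵇ_ h (unmerge a id id Γ) w (fstOf-unmerge a id id Γ) (sndOf-unmerge a id id Γ) ⟩
  ((g ∨ᵇ g) ∧ᵇ hw) ∨ᵇ R
    ≡⟨ cong (λ x → (x ∧ᵇ hw) ∨ᵇ R) (∨ᵇ-idem g) ⟩
  (g ∧ᵇ hw) ∨ᵇ R
    ∎
  where
  open ≡-Reasoning
  hw R : Bool
  hw = h (fstOf a w) (sndOf a w)
  R = evalGroupExcept a (unmerge a id id Γ) w
  Γ-merged : mergeWith a _∨ᵇ_ (unmerge a id id Γ) ≡ Γ
  Γ-merged = mergeWith-unmerge a id id Γ ∨ᵇ-idem

record RuleInversion (a : ℕ) {b : ℕ} (c : Connective) (S : List (Subset (a + suc b))) : Set where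
  field
    premise      : List (Subset (a + suc (suc b)))
    groups-true  : ∀ w → All (GroupTrue (mergeWith a (boolOp c) w)) S → All (GroupTrue w) premise
    derive       : ∀ {P} → Provable (cq _ premise P) → Provable (cq _ S (mergeWith a (connect c) P))

or-inversion : ∀ a {b} (S : List (Subset (a + suc b))) → RuleInversion a or S
or-inversion a S = record
  { premise     = map (unmerge a id id) S
  ; groups-true = λ w gs → AllP.map⁺ (All.map (unmerged w) gs)
  ; derive      = subst (λ S′ → Provable (cq _ S′ _)) merged ∘ or-rule a
  }
  where
  unmerged : ∀ w {Γ} → GroupTrue (mergeWith a _∨ᵇ_ w) Γ → GroupTrue w (unmerge a id id Γ)
  unmerged w {Γ} e = trans (evalGroup-unmerge a id id Γ w refl) (trans (sym (∧-distribˡ-∨-assoc (entryAt a Γ) _ _ _))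
                       (trans (sym (evalGroup-mergeWith-situation a _∨ᵇ_ Γ w refl)) e))
  merged : map (mergeWith a _∨ᵇ_) (map (unmerge a id id) S) ≡ S
  merged = trans (sym (LP.map-∘ S)) (trans (LP.map-cong (λ Γ → mergeWith-unmerge a id id Γ ∨ᵇ-idem) S) (LP.map-id S))

-- A group containing F ∧ G splits into one containing F followed by one
-- containing G; these are exactly the pairs that pairUnion merges back.
unmergeAnd : ∀ a {b} → List (Subset (a + suc b)) → List (Subset (a + suc (suc b)))
unmergeAnd a []      = []
unmergeAnd a (Γ ∷ S) = if entryAt a Γ
  then unmerge a id (const false) Γ ∷ unmerge a (const false) id Γ ∷ unmergeAnd a S
  else unmerge a id (const false) Γ ∷ unmergeAnd a S

unmergeAnd-paired : ∀ a {b} (S : List (Subset (a + suc b))) → AndPaired a (unmergeAnd a S)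
unmergeAnd-paired a []      = []
unmergeAnd-paired a (Γ ∷ S) with entryAt a Γ in e
... | true  = pair (trans (fstOf-unmerge a id _ Γ) e) (sndOf-unmerge a id _ Γ) (fstOf-unmerge a _ id Γ)
                   (trans (sndOf-unmerge a _ id Γ) e) (unmergeAnd-paired a S)
... | false = skip (trans (fstOf-unmerge a id _ Γ) e) (sndOf-unmerge a id _ Γ) (unmergeAnd-paired a S)

unmergeAnd-merged : ∀ a {b} (S : List (Subset (a + suc b))) → map (mergeWith a _∨ᵇ_) (pairUnion a (unmergeAnd a S)) ≡ S
unmergeAnd-merged a []      = refl
unmergeAnd-merged a (Γ ∷ S) with entryAt a Γ in e
... | true  = trans (cong (map (mergeWith a _∨ᵇ_)) (pairUnion-pair a _ _ (unmergeAnd a S) (trans (fstOf-unmerge a id _ Γ) e)))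
                (cong₂ _∷_ (trans (cong (mergeWith a _∨ᵇ_) (unmerge-∪ a id (const false) (const false) id Γ))
                                  (mergeWith-unmerge a _ _ Γ λ { false → refl ; true → refl }))
                           (unmergeAnd-merged a S))
... | false = trans (cong (map (mergeWith a _∨ᵇ_)) (pairUnion-skip a _ (unmergeAnd a S) (trans (fstOf-unmerge a id _ Γ) e)))
                (cong₂ _∷_ (mergeWith-unmerge a id (const false) Γ λ { false → refl ; true → refl }) (unmergeAnd-merged a S))

unmergeAnd-true : ∀ a {b} (S : List (Subset (a + suc b))) w →
  All (GroupTrue (mergeWith a _∧ᵇ_ w)) S → All (GroupTrue w) (unmergeAnd a S)
unmergeAnd-true a []      w []       = []
unmergeAnd-true a (Γ ∷ S) w (g ∷ gs) with entryAt a Γ in e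
... | true  = trans (evalGroup-unmerge a id _ Γ w e) (∨-monoˡ-true R (proj₁ ∘ ∧-true⁻ (fstOf a w) (sndOf a w)) merged)
            ∷ trans (evalGroup-unmerge a _ id Γ w e) (∨-monoˡ-true R (proj₂ ∘ ∧-true⁻ (fstOf a w) (sndOf a w)) merged)
            ∷ unmergeAnd-true a S w gs
  where
  R : Bool
  R = evalGroupExcept a (unmerge a id id Γ) w
  merged : (fstOf a w ∧ᵇ sndOf a w) ∨ᵇ R ≡ true
  merged = trans (sym (evalGroup-mergeWith-situation a _∧ᵇ_ Γ w e)) g
... | false = trans (evalGroup-unmerge a id _ Γ w e) (trans (sym (evalGroup-mergeWith-situation a _∧ᵇ_ Γ w e)) g)
            ∷ unmergeAnd-true a S w gs

and-inversion : ∀ a {b} (S : List (Subset (a + suc b))) → RuleInversion a and S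
and-inversion a S = record
  { premise     = unmergeAnd a S
  ; groups-true = unmergeAnd-true a S
  ; derive      = subst (λ S′ → Provable (cq _ S′ _)) (unmergeAnd-merged a S)
                  ∘ and-rule a (AndPaired⇒AndCondition a (unmergeAnd-paired a S))
  }

size : Formula → ℕ
size (atom _)  = 0
size (natom _) = 0
size (F ∧ G)   = suc (size F + size G)
size (F ∨ G)   = suc (size F + size G)

sizePool : ∀ {k} → Vec Formula k → ℕ
sizePool []      = 0
sizePool (F ∷ P) = size F + sizePool P

size-connect : ∀ c F G → size (connect c F G) ≡ suc (size F + size G)
size-connect and F G = refl
size-connect or  F G = refl

sizePool-connect : ∀ {a b} (xs : Vec Formula a) c F G (ys : Vec Formula b) →
  sizePool (xs ++ (connect c F G ∷ ys)) ≡ suc (sizePool (xs ++ (F ∷ G ∷ ys)))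
sizePool-connect []       c F G ys = begin
  size (connect c F G) + sizePool ys      ≡⟨ cong (_+ sizePool ys) (size-connect c F G) ⟩
  suc (size F + size G + sizePool ys)     ≡⟨ cong suc (+-assoc (size F) (size G) (sizePool ys)) ⟩
  suc (size F + (size G + sizePool ys))   ∎
  where open ≡-Reasoning
sizePool-connect (x ∷ xs) c F G ys =
  trans (cong (size x +_) (sizePool-connect xs c F G ys)) (+-suc (size x) _)

mergeWith-++ : ∀ {X : Set} {a b} (f : X → X → X) (xs : Vec X a) x y (ys : Vec X b) →
  mergeWith a f (xs ++ (x ∷ y ∷ ys)) ≡ xs ++ (f x y ∷ ys)
mergeWith-++ f []       x y ys = refl
mergeWith-++ f (z ∷ xs) x y ys = cong (z ∷_) (mergeWith-++ f xs x y ys)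

data PoolView : ∀ {k} → Vec Formula k → Set where
  literals : ∀ {k} {P : Vec Formula k} → VAll IsLiteral P → PoolView P
  compound : ∀ {a b} (xs : Vec Formula a) c F G (ys : Vec Formula b) → PoolView (xs ++ (connect c F G ∷ ys))

literal∷-poolView : ∀ {k F} {P : Vec Formula k} → IsLiteral F → PoolView P → PoolView (F ∷ P)
literal∷-poolView l (literals ls)          = literals (l VAll.∷ ls)
literal∷-poolView l (compound xs c F G ys) = compound (_ ∷ xs) c F G ys

poolView : ∀ {k} (P : Vec Formula k) → PoolView P
poolView []            = literals VAll.[]
poolView (atom p  ∷ P) = literal∷-poolView (atom p) (poolView P)
poolView (natom p ∷ P) = literal∷-poolView (natom p) (poolView P)
poolView ((F ∧ G) ∷ P) = compound [] and F G P
poolView ((F ∨ G) ∷ P) = compound [] or F G P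

inversion : ∀ a {b} c (S : List (Subset (a + suc b))) → RuleInversion a c S
inversion a and = and-inversion a
inversion a or  = or-inversion a

completeˢ : ∀ {k} (S : List (Subset k)) P → Acc _<_ (sizePool P) → Trivialˢ (cq k S P) → Provable (cq k S P)
completeˢ S P _ t with poolView P
... | literals ls = matched⇒provable _ S P (trivial-literals⇒matched S P ls t)
completeˢ S _ (acc smaller) t | compound {a} xs c F G ys =
  subst (λ Q → Provable (cq _ S Q)) (mergeWith-++ (connect c) xs F G ys)
    (derive (completeˢ premise (xs ++ (F ∷ G ∷ ys)) (smaller (≤-reflexive (sym (sizePool-connect xs c F G ys))))
      (Trivialˢ-unmergeWith a c S groups-true
        (subst (λ Q → Trivialˢ (cq _ S Q)) (sym (mergeWith-++ (connect c) xs F G ys)) t))))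
  where open RuleInversion (inversion a c S)

completeness : ∀ C → Trivial C → Provable C
completeness C@(cq k S P) t = completeˢ S P (<-wellFounded (sizePool P)) (Trivial⇒Trivialˢ C t)

theorem8p13 : ((C : Cirquent) → Provable C ⇔ Trivial C)
    × ((F : Formula) → Provable (formulaCirquent F) ⇔ Trivial (formulaCirquent F))
theorem8p13 = (λ C → mk⇔ soundness (completeness C)) , (λ F → mk⇔ soundness (completeness (formulaCirquent F)))
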